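{- For any equivalence relations $E$ and $F$ on $\mathbb N$: (a) $E\leq E^+$; (b) if $E$ has only finitely many classes, then $E<E^+$; (c) if $E\leq F$ then $E^+\leq F^+$.
   Context: $E\leq F$ (computable reducibility) means there is a total computable $f\colon\mathbb N\to\mathbb N$ with $n\mathrel{E}n'\iff f(n)\mathrel{F}f(n')$; $E<F$ means $E\leq F$ and $F\not\leq E$. $\phi_e$ is the $e$-th partial computable function. The computable FS-jump of $E$ is the equivalence relation $E^+$ on $\mathbb N$ with $e\mathrel{E^+}e'$ iff $\{[\phi_e(n)]_E:\phi_e(n)\downarrow\}=\{[\phi_{e'}(n)]_E:\phi_{e'}(n)\downarrow\}$. -}

module Defs where

open import Data.Nat using (ℕ; zero; suc; _≟_)
open import Data.Nat.Base using (_<ᵇ_)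
open import Data.Bool using (Bool; true; false; if_then_else_)
open import Data.Fin using (Fin)
open import Data.List using (List; []; _∷_; length; lookup)
open import Data.Maybe using (Maybe; just; nothing)
open import Data.Product using (_×_; _,_; ∃; ∃-syntax; Σ-syntax)
open import Relation.Nullary using (¬_; yes; no)
open import Relation.Binary using (Rel)
open import Relation.Binary.PropositionalEquality using (_≡_)
open import Level using (0ℓ)

-- Model of computation: unlimited register machines (Minsky machines).

data Instr : Set where
  inc   : ℕ → Instr
  decjz : ℕ → ℕ → Instr

Prog : Set
Prog = List Instr

record State : Set where
  constructor st
  field
    pc   : ℕ
    regs : ℕ → ℕ

update : (ℕ → ℕ) → ℕ → ℕ → (ℕ → ℕ)
update f r v x with x ≟ r
... | yes _ = v
... | no  _ = f x

nth : Prog → ℕ → Maybe Instr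
nth []      _       = nothing
nth (i ∷ p) zero    = just i
nth (i ∷ p) (suc n) = nth p n

pred : ℕ → ℕ
pred zero    = zero
pred (suc n) = n

step : Prog → State → Maybe State
step p (st c R) with nth p c
... | nothing = nothing
... | just (inc r) = just (st (suc c) (update R r (suc (R r))))
... | just (decjz r j) with R r
...   | zero  = just (st j R)
...   | suc v = just (st (suc c) (update R r v))

run : ℕ → Prog → State → Maybe ℕ
run zero    p s = nothing
run (suc k) p s with step p s
... | nothing = just (State.regs s 0)
... | just s' = run k p s'

initial : ℕ → State
initial n = st 0 (λ { zero → n ; (suc _) → 0 })

-- Gödel numbering of programs.
-- Cantor-style enumeration of ℕ × ℕ (a bijection ℕ → ℕ × ℕ).

unpair : ℕ → ℕ × ℕ
unpair zero = 0 , 0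
unpair (suc n) with unpair n
... | zero  , b = suc b , 0
... | suc a , b = a , suc b

decodeInstr : ℕ → Instr
decodeInstr n with unpair n
... | zero  , x = inc x
... | suc _ , x with unpair x
...   | r , j = decjz r j

-- lists of naturals: 0 ↦ [], suc n ↦ h ∷ t where (h , t) = unpair n.
-- The first argument is fuel (the second component of unpair (suc n) is ≤ n,
-- so fuel n suffices for decoding n).
decodeList : ℕ → ℕ → List ℕ
decodeList _        zero    = []
decodeList zero     (suc n) = []
decodeList (suc k)  (suc n) with unpair n
... | h , t = h ∷ decodeList k t

mapL : {A B : Set} → (A → B) → List A → List B
mapL f []       = []
mapL f (x ∷ xs) = f x ∷ mapL f xs

decode : ℕ → Prog
decode e = mapL decodeInstr (decodeList e e)

_·_↓=_ : ℕ → ℕ → ℕ → Set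
e · n ↓= v = ∃[ k ] run k (decode e) (initial n) ≡ just v

Computable : (ℕ → ℕ) → Set
Computable f = ∃[ e ] (∀ n → e · n ↓= f n)

_≤c_ : Rel ℕ 0ℓ → Rel ℕ 0ℓ → Set
E ≤c F = ∃[ f ] (Computable f × (∀ n n' → (E n n' → F (f n) (f n')) × (F (f n) (f n') → E n n')))

_<c_ : Rel ℕ 0ℓ → Rel ℕ 0ℓ → Set
E <c F = E ≤c F × ¬ (F ≤c E)

-- computable FS-jump:  e E⁺ e'  iff  {[φ_e(n)]_E} = {[φ_e'(n)]_E}
Jump : Rel ℕ 0ℓ → Rel ℕ 0ℓ
Jump E e e' =
    (∀ n v → e · n ↓= v → ∃[ m ] ∃[ w ] (e' · m ↓= w × E v w))
  × (∀ m w → e' · m ↓= w → ∃[ n ] ∃[ v ] (e · n ↓= v × E v w))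

FinitelyManyClasses : Rel ℕ 0ℓ → Set
FinitelyManyClasses E = Σ[ k ∈ ℕ ] Σ[ r ∈ (Fin k → ℕ) ] (∀ (x : ℕ) → ∃[ i ] E x (r i))

-- (a) Sending n to an index of the constant function n reduces E to E⁺.
-- (b) If g reduced E⁺ to E, then x ↦ g (const x) would be a self-reduction of E whose image avoids the
-- class of g (index of the empty function); the orbit of that point is then pairwise inequivalent,
-- so E has infinitely many classes.
-- (c) If f reduces E to F, then e ↦ an index of f ∘ φ_e reduces E⁺ to F⁺. Almost all of the work is
-- showing that this index is computable from e in the concrete machine model: programs are written in
-- a small structured language compiled to register machines, and one such program reads the code of e,
-- relocates its registers and jump targets, and splices it between code that moves the input out of
-- the way and the output back, followed by a relocated copy of the program for f.
module Submission where

open import Defs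
open import Data.Bool using (Bool; true; false; _∨_; T; not)
open import Data.Empty using (⊥; ⊥-elim)
open import Data.Fin using (Fin; toℕ)
import Data.Fin.Properties as FinP
open import Data.List using (List; []; _∷_; length; _++_; replicate; reverse; map)
open import Data.List.Properties using (length-++; length-replicate; ++-assoc; ++-identityʳ; map-++; reverse-map; reverse-involutive; unfold-reverse)
open import Data.Maybe using (Maybe; just; nothing)
open import Data.Maybe.Properties using (just-injective)
open import Data.Nat using (ℕ; zero; suc; _+_; _∸_; _≤_; _<_; z≤n; s≤s; _≟_; _≡ᵇ_; _⊓_; _⊔_)
open import Data.Nat.Properties
open import Data.Product using (Σ; _×_; _,_; ∃-syntax; proj₁; proj₂)
open import Data.Product.Properties using (,-injectiveˡ; ,-injectiveʳ)
open import Data.Unit using (⊤; tt)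
open import Function using (case_of_)
open import Level using (0ℓ)
open import Relation.Binary using (Rel; IsEquivalence)
open import Relation.Binary.PropositionalEquality
open import Relation.Nullary using (¬_; yes; no)

infixr 0 _▸_
_▸_ : ∀ {A : Set} {B : A → Set} {G : Set} → Σ A B → ((a : A) → B a → G) → G
(a , b) ▸ k = k a b

cong₃ : ∀ (f : ℕ → ℕ → ℕ → ℕ) {x y z x' y' z'} → x ≡ x' → y ≡ y' → z ≡ z' → f x y z ≡ f x' y' z'
cong₃ f refl refl refl = refl

cong₄ : ∀ (f : ℕ → ℕ → ℕ → ℕ → ℕ) {x y z w x' y' z' w'} → x ≡ x' → y ≡ y' → z ≡ z' → w ≡ w' → f x y z w ≡ f x' y' z' w'
cong₄ f refl refl refl refl = refl

module Coding where

  triangle : ℕ → ℕ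
  triangle zero = zero
  triangle (suc s) = suc s + triangle s

  unpair-suc0 : ∀ m b → unpair m ≡ (0 , b) → unpair (suc m) ≡ (suc b , 0)
  unpair-suc0 m b e rewrite e = refl

  unpair-sucS : ∀ m a b → unpair m ≡ (suc a , b) → unpair (suc m) ≡ (a , suc b)
  unpair-sucS m a b e rewrite e = refl

  unpair-diagonal : ∀ s b → b ≤ s → unpair (triangle s + b) ≡ (s ∸ b , b)
  unpair-diagonal zero .zero z≤n = refl
  unpair-diagonal (suc s) zero z≤n = lem
    where
    lem : unpair (triangle (suc s) + 0) ≡ (suc s , 0)
    eq : triangle (suc s) + 0 ≡ suc (triangle s + s)
    eq = trans (+-identityʳ _) (cong suc (+-comm s (triangle s)))
    e2 : unpair (triangle s + s) ≡ (0 , s)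
    e2 = trans (unpair-diagonal s s ≤-refl) (cong (_, s) (n∸n≡0 s))
    lem = trans (cong unpair eq) (unpair-suc0 (triangle s + s) s e2)
  unpair-diagonal (suc s) (suc b) (s≤s b≤s) =
    trans (cong unpair (+-suc (triangle (suc s)) b))
     (unpair-sucS (triangle (suc s) + b) (s ∸ b) b (trans (unpair-diagonal (suc s) b (m≤n⇒m≤1+n b≤s)) (cong (_, b) (+-∸-assoc 1 b≤s))))

  abstract
    pair : ℕ → ℕ → ℕ
    pair a b = triangle (a + b) + b

    unpair-pair : ∀ a b → unpair (pair a b) ≡ (a , b)
    unpair-pair a b rewrite unpair-diagonal (a + b) b (m≤n+m b a) | m+n∸n≡m a b = refl

    pair-≥ : ∀ a b → b ≤ pair a b
    pair-≥ a b = m≤n+m b (triangle (a + b))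

    pair-def : ∀ a b → pair a b ≡ triangle (a + b) + b
    pair-def a b = refl

    pair-0-0 : pair 0 0 ≡ 0
    pair-0-0 = refl

  encodeList : List ℕ → ℕ
  encodeList [] = 0
  encodeList (h ∷ t) = suc (pair h (encodeList t))

  decodeList-cons : ∀ k h t → decodeList (suc k) (suc (pair h t)) ≡ h ∷ decodeList k t
  decodeList-cons k h t rewrite unpair-pair h t = refl

  length≤encodeList : ∀ l → length l ≤ encodeList l
  length≤encodeList [] = z≤n
  length≤encodeList (h ∷ t) = s≤s (≤-trans (length≤encodeList t) (pair-≥ h (encodeList t)))

  decodeList-encodeList : ∀ k l → length l ≤ k → decodeList k (encodeList l) ≡ l
  decodeList-encodeList k [] _ with k
  ... | zero = refl
  ... | suc _ = refl
  decodeList-encodeList (suc k) (h ∷ t) (s≤s le) rewrite decodeList-cons k h (encodeList t)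
    | decodeList-encodeList k t le = refl

  decodeList-self : ∀ l → decodeList (encodeList l) (encodeList l) ≡ l
  decodeList-self l = decodeList-encodeList (encodeList l) l (length≤encodeList l)

  encodeInstr : Instr → ℕ
  encodeInstr (inc x) = pair 0 x
  encodeInstr (decjz r j) = pair 1 (pair r j)

  decodeInstr-encodeInstr : ∀ i → decodeInstr (encodeInstr i) ≡ i
  decodeInstr-encodeInstr (inc x) rewrite unpair-pair 0 x = refl
  decodeInstr-encodeInstr (decjz r j) rewrite unpair-pair 1 (pair r j) | unpair-pair r j = refl

  encode : Prog → ℕ
  encode p = encodeList (mapL encodeInstr p)

  mapL-decode-encode : ∀ p → mapL decodeInstr (mapL encodeInstr p) ≡ p
  mapL-decode-encode [] = refl
  mapL-decode-encode (i ∷ p) = cong₂ _∷_ (decodeInstr-encodeInstr i) (mapL-decode-encode p)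

  decode-encode : ∀ p → decode (encode p) ≡ p
  decode-encode p rewrite decodeList-self (mapL encodeInstr p) = mapL-decode-encode p

  step-inc : ∀ p c R r → nth p c ≡ just (inc r) → step p (st c R) ≡ just (st (suc c) (update R r (suc (R r))))
  step-inc p c R r eq rewrite eq = refl

  step-jz : ∀ p c R r j → nth p c ≡ just (decjz r j) → R r ≡ 0 → step p (st c R) ≡ just (st j R)
  step-jz p c R r j eq z rewrite eq | z = refl

  step-dec : ∀ p c R r j v → nth p c ≡ just (decjz r j) → R r ≡ suc v → step p (st c R) ≡ just (st (suc c) (update R r v))
  step-dec p c R r j v eq z rewrite eq | z = refl

  step-halt : ∀ p c R → nth p c ≡ nothing → step p (st c R) ≡ nothing
  step-halt p c R eq rewrite eq = refl

  nth-len : ∀ p → nth p (length p) ≡ nothing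
  nth-len [] = refl
  nth-len (_ ∷ p) = nth-len p

  nth-++ : ∀ p q i → nth (p ++ q) (length p + i) ≡ nth q i
  nth-++ [] q i = refl
  nth-++ (_ ∷ p) q i = nth-++ p q i

  data Steps (p : Prog) : State → State → Set where
    done : ∀ {s} → Steps p s s
    more : ∀ {s s' s''} → step p s ≡ just s' → Steps p s' s'' → Steps p s s''

  Steps-trans : ∀ {p s1 s2 s3} → Steps p s1 s2 → Steps p s2 s3 → Steps p s1 s3
  Steps-trans done b = b
  Steps-trans (more x a) b = more x (Steps-trans a b)

  run-step : ∀ k p s s' → step p s ≡ just s' → run (suc k) p s ≡ run k p s'
  run-step k p s s' e with step p s | e
  ... | just _ | refl = refl

  run-halted : ∀ k p s → step p s ≡ nothing → run (suc k) p s ≡ just (State.regs s 0)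
  run-halted k p s e with step p s | e
  ... | nothing | refl = refl

  Steps-halt : ∀ {p s s'} → Steps p s s' → step p s' ≡ nothing → ∃[ k ] run k p s ≡ just (State.regs s' 0)
  Steps-halt {p} {s} done h = 1 , run-halted 0 p s h
  Steps-halt {p} {s} (more {s' = s'} x r) h with Steps-halt r h
  ... | k , eq = suc k , trans (run-step k p s s' x) eq

  run-deterministic : ∀ k k' p s {a b} → run k p s ≡ just a → run k' p s ≡ just b → a ≡ b
  run-deterministic zero k' p s () e2
  run-deterministic (suc k) zero p s e1 ()
  run-deterministic (suc k) (suc k') p s e1 e2 with step p s
  ... | nothing = trans (sym (just-injective e1)) (just-injective e2)
  ... | just s' = run-deterministic k k' p s' e1 e2

  ↓=-deterministic : ∀ {e m a b} → e · m ↓= a → e · m ↓= b → a ≡ b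
  ↓=-deterministic {e} {m} (k , r) (k' , r') = run-deterministic k k' (decode e) (initial m) r r'

open Coding

module Structured where

  infixr 4 _⨾_
  data Cmd : Set where
    SKIP : Cmd
    INC  : ℕ → Cmd
    DEC  : ℕ → Cmd
    _⨾_  : Cmd → Cmd → Cmd
    LOOP : ℕ → Cmd → Cmd
    IFZ  : ℕ → Cmd → Cmd → Cmd
    ADDC : ℕ → ℕ → Cmd

  size : Cmd → ℕ
  size SKIP = 0
  size (INC r) = 1
  size (DEC r) = 1
  size (c1 ⨾ c2) = size c1 + size c2
  size (LOOP r c) = suc (suc (size c))
  size (IFZ r c1 c2) = suc (suc (suc (size c2 + size c1)))
  size (ADDC r n) = n

  -- Compiled programs never touch this register, so a decjz on it is an unconditional jump.
  zeroReg : ℕ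
  zeroReg = 1

  compile : ℕ → Cmd → Prog
  compile o SKIP = []
  compile o (INC r) = inc r ∷ []
  compile o (DEC r) = decjz r (suc o) ∷ []
  compile o (c1 ⨾ c2) = compile o c1 ++ compile (o + size c1) c2
  compile o (LOOP r c) = decjz r (o + size (LOOP r c)) ∷ (compile (suc o) c ++ (decjz zeroReg o ∷ []))
  compile o (IFZ r c1 c2) =
    decjz r (suc (suc (suc o) + size c2)) ∷ inc r ∷
      (compile (suc (suc o)) c2 ++ (decjz zeroReg (o + size (IFZ r c1 c2)) ∷ compile (suc (suc (suc o) + size c2)) c1))

  compile o (ADDC r n) = replicate n (inc r)

  length-compile : ∀ o c → length (compile o c) ≡ size c
  length-compile o SKIP = refl
  length-compile o (INC r) = refl
  length-compile o (DEC r) = refl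
  length-compile o (c1 ⨾ c2) rewrite length-++ (compile o c1) {compile (o + size c1) c2}
    | length-compile o c1 | length-compile (o + size c1) c2 = refl
  length-compile o (LOOP r c) rewrite length-++ (compile (suc o) c) {decjz zeroReg o ∷ []}
    | length-compile (suc o) c | +-comm (size c) 1 = refl
  length-compile o (IFZ r c1 c2)
    rewrite length-++ (compile (suc (suc o)) c2) {decjz zeroReg (o + size (IFZ r c1 c2)) ∷ compile (suc (suc (suc o) + size c2)) c1}
    | length-compile (suc (suc o)) c2 | length-compile (suc (suc (suc o) + size c2)) c1 | +-suc (size c2) (size c1) = refl
  length-compile o (ADDC r n) = length-replicate n

  -- IFZ tests its register by a decrement followed by an increment.
  bump : (ℕ → ℕ) → ℕ → ℕ → (ℕ → ℕ)
  bump R r v = update (update R r v) r (suc (update R r v r))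

  addc : (ℕ → ℕ) → ℕ → ℕ → (ℕ → ℕ)
  addc R r zero = R
  addc R r (suc n) = addc (update R r (suc (R r))) r n

  data _⊢_⇓_ : Cmd → (ℕ → ℕ) → (ℕ → ℕ) → Set where
    skip  : ∀ {R} → SKIP ⊢ R ⇓ R
    inc   : ∀ {r R} → INC r ⊢ R ⇓ update R r (suc (R r))
    dec0  : ∀ {r R} → R r ≡ 0 → DEC r ⊢ R ⇓ R
    decS  : ∀ {r R v} → R r ≡ suc v → DEC r ⊢ R ⇓ update R r v
    seq   : ∀ {c1 c2 R S T} → c1 ⊢ R ⇓ S → c2 ⊢ S ⇓ T → (c1 ⨾ c2) ⊢ R ⇓ T
    loop0 : ∀ {r c R} → R r ≡ 0 → LOOP r c ⊢ R ⇓ R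
    loopS : ∀ {r c R S T v} → R r ≡ suc v → c ⊢ update R r v ⇓ S → LOOP r c ⊢ S ⇓ T → LOOP r c ⊢ R ⇓ T
    ifz0  : ∀ {r c1 c2 R S} → R r ≡ 0 → c1 ⊢ R ⇓ S → IFZ r c1 c2 ⊢ R ⇓ S
    ifzS  : ∀ {r c1 c2 R S v} → R r ≡ suc v → c2 ⊢ bump R r v ⇓ S → IFZ r c1 c2 ⊢ R ⇓ S
    addcR : ∀ {r n R} → ADDC r n ⊢ R ⇓ addc R r n

  update-same : ∀ R r v → update R r v r ≡ v
  update-same R r v with r ≟ r
  ... | yes _ = refl
  ... | no ne = ⊥-elim (ne refl)

  update-other : ∀ R r v x → x ≢ r → update R r v x ≡ R x
  update-other R r v x ne with x ≟ r
  ... | yes e = ⊥-elim (ne e)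
  ... | no _ = refl

  bump-eq : ∀ R r v → R r ≡ suc v → ∀ x → bump R r v x ≡ R x
  bump-eq R r v e x with x ≟ r
  ... | yes refl = trans (cong suc (update-same R x v)) (sym e)
  ... | no ne = update-other R r v x ne

  uses : Cmd → ℕ → Bool
  uses SKIP x = false
  uses (INC r) x = x ≡ᵇ r
  uses (DEC r) x = x ≡ᵇ r
  uses (c1 ⨾ c2) x = uses c1 x ∨ uses c2 x
  uses (LOOP r c) x = (x ≡ᵇ r) ∨ uses c x
  uses (IFZ r c1 c2) x = (x ≡ᵇ r) ∨ (uses c1 x ∨ uses c2 x)
  uses (ADDC r n) x = x ≡ᵇ r

  ∨-false-l : ∀ a b → (a ∨ b) ≡ false → a ≡ false
  ∨-false-l false b e = refl

  ∨-false-r : ∀ a b → (a ∨ b) ≡ false → b ≡ false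
  ∨-false-r false b e = e

  ∨-false : ∀ {a b : Bool} → a ≡ false → b ≡ false → (a ∨ b) ≡ false
  ∨-false refl refl = refl

  ≡ᵇ-false : ∀ x r → (x ≡ᵇ r) ≡ false → x ≢ r
  ≡ᵇ-false x .x e refl = subst T e (≡⇒≡ᵇ x x refl)

  addc-other : ∀ R r n x → x ≢ r → addc R r n x ≡ R x
  addc-other R r zero x ne = refl
  addc-other R r (suc n) x ne = trans (addc-other _ r n x ne) (update-other R r _ x ne)

  addc-same : ∀ R r n → addc R r n r ≡ R r + n
  addc-same R r zero = sym (+-identityʳ _)
  addc-same R r (suc n) = trans (addc-same _ r n) (trans (cong (_+ n) (update-same R r _)) (sym (+-suc (R r) n)))

  frame : ∀ {c R R'} → c ⊢ R ⇓ R' → ∀ x → uses c x ≡ false → R' x ≡ R x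
  frame skip x m = refl
  frame {INC r} {R} inc x m = update-other R r _ x (≡ᵇ-false x r m)
  frame (dec0 _) x m = refl
  frame {DEC r} {R} (decS _) x m = update-other R r _ x (≡ᵇ-false x r m)
  frame {c1 ⨾ c2} (seq d1 d2) x m =
    trans (frame d2 x (∨-false-r (uses c1 x) _ m)) (frame d1 x (∨-false-l (uses c1 x) _ m))
  frame (loop0 _) x m = refl
  frame {LOOP r c} {R} (loopS e d1 d2) x m =
    trans (frame d2 x m) (trans (frame d1 x (∨-false-r (x ≡ᵇ r) _ m))
      (update-other R r _ x (≡ᵇ-false x r (∨-false-l (x ≡ᵇ r) _ m))))
  frame {IFZ r c1 c2} (ifz0 _ d) x m = frame d x (∨-false-l (uses c1 x) _ (∨-false-r (x ≡ᵇ r) _ m))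
  frame {IFZ r c1 c2} {R} (ifzS {v = v} e d) x m =
    trans (frame d x (∨-false-r (uses c1 x) _ (∨-false-r (x ≡ᵇ r) _ m))) (bump-eq R r v e x)
  frame {ADDC r n} {R} addcR x m = addc-other R r n x (≡ᵇ-false x r m)

  T-not : ∀ b → T (not b) → b ≡ false
  T-not false _ = refl

  -- For a concrete command and register the side condition normalises to ⊤ and is filled in by Agda.
  kept : ∀ {c R R'} → c ⊢ R ⇓ R' → ∀ x → {m : T (not (uses c x))} → R' x ≡ R x
  kept {c} d x {m} = frame d x (T-not (uses c x) m)

  record Contains (P : Prog) (o : ℕ) (q : Prog) : Set where
    constructor mkC
    field get : ∀ i x → nth q i ≡ just x → nth P (o + i) ≡ just x
  open Contains

  cont-head : ∀ {P o a q} → Contains P o (a ∷ q) → nth P o ≡ just a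
  cont-head {P} {o} h = subst (λ k → nth P k ≡ _) (+-identityʳ o) (get h 0 _ refl)

  cont-tail : ∀ {P o a q} → Contains P o (a ∷ q) → Contains P (suc o) q
  cont-tail {P} {o} h = mkC λ i x e → subst (λ k → nth P k ≡ just x) (+-suc o i) (get h (suc i) x e)

  nth-++ˡ : ∀ p q i x → nth p i ≡ just x → nth (p ++ q) i ≡ just x
  nth-++ˡ (y ∷ p) q zero x e = e
  nth-++ˡ (y ∷ p) q (suc i) x e = nth-++ˡ p q i x e

  cont-left : ∀ {P o} q1 q2 → Contains P o (q1 ++ q2) → Contains P o q1
  cont-left q1 q2 h = mkC λ i x e → get h i x (nth-++ˡ q1 q2 i x e)

  cont-right : ∀ {P o} q1 q2 → Contains P o (q1 ++ q2) → Contains P (o + length q1) q2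
  cont-right {P} {o} q1 q2 h = mkC λ i x e →
    subst (λ k → nth P k ≡ just x) (sym (+-assoc o (length q1) i))
      (get h (length q1 + i) x (trans (nth-++ q1 q2 i) e))

  cont-refl : ∀ P → Contains P 0 P
  cont-refl P = mkC λ i x e → e

  replicate-inc-Steps : ∀ {P r} n R o → Contains P o (replicate n (inc r)) → Steps P (st o R) (st (o + n) (addc R r n))
  replicate-inc-Steps zero R o h rewrite +-identityʳ o = done
  replicate-inc-Steps {P} {r} (suc n) R o h = more (step-inc P o R r (cont-head h))
    (subst (λ k → Steps P (st (suc o) (update R r (suc (R r)))) (st k (addc (update R r (suc (R r))) r n)))
      (sym (+-suc o n)) (replicate-inc-Steps n _ (suc o) (cont-tail h)))

  IFZ-end : ∀ o a b → suc (suc (suc o) + a) + b ≡ o + suc (suc (suc (a + b)))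
  IFZ-end o a b = begin
    suc (suc (suc o) + a) + b   ≡⟨ cong (_+ b) (sym (+-suc (suc (suc o)) a)) ⟩
    suc (suc o) + suc a + b     ≡⟨ cong (_+ b) (sym (+-suc (suc o) (suc a))) ⟩
    suc o + suc (suc a) + b     ≡⟨ cong (_+ b) (sym (+-suc o (suc (suc a)))) ⟩
    o + suc (suc (suc a)) + b   ≡⟨ +-assoc o (suc (suc (suc a))) b ⟩
    o + suc (suc (suc (a + b))) ∎
    where open ≡-Reasoning

  compile-correct : ∀ {c R R'} → c ⊢ R ⇓ R' → ∀ {P o} → R zeroReg ≡ 0 → uses c zeroReg ≡ false →
            Contains P o (compile o c) → Steps P (st o R) (st (o + size c) R')
  compile-correct skip {o = o} z m h rewrite +-identityʳ o = done
  compile-correct {INC r} {R} (inc) {P} {o} z m h rewrite +-comm o 1 =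
    more (step-inc P o R r (cont-head h)) done
  compile-correct {DEC r} {R} (dec0 e) {P} {o} z m h rewrite +-comm o 1 =
    more (step-jz P o R r (suc o) (cont-head h) e) done
  compile-correct {DEC r} {R} (decS {v = v} e) {P} {o} z m h rewrite +-comm o 1 =
    more (step-dec P o R r (suc o) v (cont-head h) e) done
  compile-correct {c1 ⨾ c2} {R} {R'} (seq d1 d2) {P} {o} z m h =
    subst (λ k → Steps P (st o R) (st k R')) (+-assoc o (size c1) (size c2))
     (Steps-trans (compile-correct d1 z m1 (cont-left (compile o c1) _ h))
       (compile-correct d2 (trans (frame d1 zeroReg m1) z) (∨-false-r (uses c1 zeroReg) _ m)
         (subst (λ k → Contains P (o + k) (compile (o + size c1) c2)) (length-compile o c1) (cont-right (compile o c1) _ h))))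
    where m1 = ∨-false-l (uses c1 zeroReg) _ m
  compile-correct {LOOP r c} {R} (loop0 e) {P} {o} z m h =
    more (step-jz P o R r _ (cont-head h) e) done
  compile-correct {LOOP r c} {R} (loopS {S = S} {v = v} e d1 d2) {P} {o} z m h =
    more (step-dec P o R r _ v (cont-head h) e)
     (Steps-trans (compile-correct d1 (trans (update-other R r v zeroReg (≡ᵇ-false zeroReg r mr)) z) mc hb)
       (more (step-jz P (suc o + size c) S zeroReg o back zS)
         (compile-correct d2 zS m h)))
    where
    mr = ∨-false-l (zeroReg ≡ᵇ r) _ m
    mc = ∨-false-r (zeroReg ≡ᵇ r) _ m
    ht = cont-tail h
    hb = cont-left (compile (suc o) c) _ ht
    zS : S zeroReg ≡ 0
    zS = trans (frame d1 zeroReg mc) (trans (update-other R r v zeroReg (≡ᵇ-false zeroReg r mr)) z)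
    back : nth P (suc o + size c) ≡ just (decjz zeroReg o)
    back = subst (λ k → nth P (suc o + k) ≡ just (decjz zeroReg o)) (length-compile (suc o) c)
             (cont-head (cont-right (compile (suc o) c) _ ht))
  compile-correct {IFZ r c1 c2} {R} {R'} (ifz0 e d) {P} {o} z m h =
    more (step-jz P o R r _ (cont-head h) e)
      (subst (λ k → Steps P (st (suc (suc (suc o) + size c2)) R) (st k R')) (IFZ-end o (size c2) (size c1))
        (compile-correct d z m1 h1))
    where
    m1 = ∨-false-l (uses c1 zeroReg) _ (∨-false-r (zeroReg ≡ᵇ r) _ m)
    ht = cont-tail (cont-tail h)
    h1' = cont-tail (cont-right (compile (suc (suc o)) c2) _ ht)
    h1 : Contains P (suc (suc (suc o) + size c2)) (compile (suc (suc (suc o) + size c2)) c1)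
    h1 = subst (λ k → Contains P (suc (suc (suc o) + k)) (compile (suc (suc (suc o) + size c2)) c1)) (length-compile (suc (suc o)) c2) h1'
  compile-correct {IFZ r c1 c2} {R} (ifzS {S = S} {v = v} e d) {P} {o} z m h =
    more (step-dec P o R r _ v (cont-head h) e)
     (more (step-inc P (suc o) (update R r v) r (cont-head (cont-tail h)))
      (Steps-trans (compile-correct d zb m2 h2)
        (more (step-jz P (suc (suc o) + size c2) S zeroReg _ jmp zS) done)))
    where
    m2 = ∨-false-r (uses c1 zeroReg) _ (∨-false-r (zeroReg ≡ᵇ r) _ m)
    ht = cont-tail (cont-tail h)
    h2 = cont-left (compile (suc (suc o)) c2) _ ht
    zb : bump R r v zeroReg ≡ 0
    zb = trans (bump-eq R r v e zeroReg) z
    zS : S zeroReg ≡ 0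
    zS = trans (frame d zeroReg m2) zb
    jmp : nth P (suc (suc o) + size c2) ≡ just (decjz zeroReg (o + size (IFZ r c1 c2)))
    jmp = subst (λ k → nth P (suc (suc o) + k) ≡ just (decjz zeroReg (o + size (IFZ r c1 c2)))) (length-compile (suc (suc o)) c2)
             (cont-head (cont-right (compile (suc (suc o)) c2) _ ht))

  compile-correct addcR z m h = replicate-inc-Steps _ _ _ h

  inputRegs : ℕ → ℕ → ℕ
  inputRegs n = State.regs (initial n)

  compiled : Cmd → Prog
  compiled c = compile 0 c

  indexOf : Cmd → ℕ
  indexOf c = encode (compiled c)

  indexOf-converges : ∀ c n R' → c ⊢ inputRegs n ⇓ R' → uses c zeroReg ≡ false → indexOf c · n ↓= R' 0
  indexOf-converges c n R' d m rewrite decode-encode (compiled c) =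
    Steps-halt (compile-correct d refl m (cont-refl (compiled c)))
      (step-halt (compiled c) (size c) R' (subst (λ k → nth (compiled c) k ≡ nothing) (length-compile 0 c) (nth-len (compiled c))))

  computable-by : ∀ c (g : ℕ → ℕ) → uses c zeroReg ≡ false →
    (∀ n → ∃[ R' ] (c ⊢ inputRegs n ⇓ R') × R' 0 ≡ g n) → Computable g
  computable-by c g m h = indexOf c , λ n → lem n (h n)
    where lem : ∀ n → (∃[ R' ] (c ⊢ inputRegs n ⇓ R') × R' 0 ≡ g n) → indexOf c · n ↓= g n
          lem n (R' , d , e) = subst (λ v → indexOf c · n ↓= v) e (indexOf-converges c n R' d m)

open Structured

module Macros where

  ≢⇒≡ᵇ-false : ∀ {x r} → x ≢ r → (x ≡ᵇ r) ≡ false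
  ≢⇒≡ᵇ-false {x} {r} ne with x ≡ᵇ r in eq
  ... | false = refl
  ... | true = ⊥-elim (ne (≡ᵇ⇒≡ x r (subst T (sym eq) _)))


  CLR : ℕ → Cmd
  CLR r = LOOP r SKIP

  abstract
    CLR-ok : ∀ r R → ∃[ R' ] (CLR r ⊢ R ⇓ R') × R' r ≡ 0
    CLR-ok r R = go (R r) R refl
      where
      go : ∀ n R → R r ≡ n → ∃[ R' ] (CLR r ⊢ R ⇓ R') × R' r ≡ 0
      go zero R e = R , loop0 e , e
      go (suc n) R e with go n (update R r n) (update-same R r n)
      ... | R' , d , p = R' , loopS e skip d , p

  MOV : ℕ → ℕ → Cmd
  MOV s d = LOOP s (INC d)

  abstract
    MOV-ok : ∀ s d → s ≢ d → ∀ R → ∃[ R' ] (MOV s d ⊢ R ⇓ R') × R' d ≡ R d + R s × R' s ≡ 0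
    MOV-ok s d ne R = go (R s) R refl
      where
      go : ∀ n R → R s ≡ n → ∃[ R' ] (MOV s d ⊢ R ⇓ R') × R' d ≡ R d + n × R' s ≡ 0
      go zero R e = R , loop0 e , sym (+-identityʳ _) , e
      go (suc n) R e with go n (update (update R s n) d (suc (update R s n d)))
                           (trans (update-other _ d _ s ne) (update-same R s n))
      ... | R' , der , p , q = R' , loopS e inc der ,
            trans p (trans (cong (_+ n) (trans (update-same _ d _) (cong suc (update-other R s n d (λ e → ne (sym e))))))
                           (sym (+-suc (R d) n))) , q

  COPY : ℕ → ℕ → ℕ → Cmd
  COPY s d t = CLR t ⨾ LOOP s (INC d ⨾ INC t) ⨾ MOV t s

  abstract
    COPY-ok : ∀ s d t → s ≢ d → s ≢ t → d ≢ t → ∀ R →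
      ∃[ R' ] (COPY s d t ⊢ R ⇓ R') × R' d ≡ R d + R s × R' s ≡ R s × R' t ≡ 0
    COPY-ok s d t sd st' dt R with CLR-ok t R
    ... | R1 , d1 , t0 with go (R1 s) R1 refl
      where
      go : ∀ n R → R s ≡ n → ∃[ R' ] (LOOP s (INC d ⨾ INC t) ⊢ R ⇓ R') × R' d ≡ R d + n × R' t ≡ R t + n × R' s ≡ 0
      go zero R e = R , loop0 e , sym (+-identityʳ _) , sym (+-identityʳ _) , e
      go (suc n) R e with go n (update (update (update R s n) d (suc (update R s n d))) t
                                (suc (update (update R s n) d (suc (update R s n d)) t)))
                           (trans (update-other _ t _ s st') (trans (update-other _ d _ s sd) (update-same R s n)))
      ... | R' , der , p , q , z = R' , loopS e (seq inc inc) der ,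
            trans p (trans (cong (_+ n) (trans (update-other _ t _ d dt)
               (trans (update-same _ d _) (cong suc (update-other R s n d (λ e → sd (sym e))))))) (sym (+-suc (R d) n))) ,
            trans q (trans (cong (_+ n) (trans (update-same _ t _)
               (cong suc (trans (update-other _ d _ t (λ e → dt (sym e))) (update-other R s n t (λ e → st' (sym e)))))))
               (sym (+-suc (R t) n))) , z
    ... | R2 , d2 , p2 , q2 , z2 with MOV-ok t s (λ e → st' (sym e)) R2
    ... | R3 , d3 , p3 , q3 = R3 , seq d1 (seq d2 d3) ,
         trans (frame d3 d (∨-false (≢⇒≡ᵇ-false dt) (≢⇒≡ᵇ-false (λ e → sd (sym e))))) (trans p2 (cong₂ _+_ (frame d1 d (∨-false (≢⇒≡ᵇ-false dt) refl)) s1)) ,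
         trans p3 (trans (cong₂ _+_ z2 (trans q2 (cong (_+ R1 s) t0))) s1) ,
         q3
      where
      s1 : R1 s ≡ R s
      s1 = frame d1 s (∨-false (≢⇒≡ᵇ-false st') refl)

  sumBelow : ℕ → ℕ
  sumBelow zero = 0
  sumBelow (suc n) = n + sumBelow n

  triangle≡n+sumBelow : ∀ n → triangle n ≡ n + sumBelow n
  triangle≡n+sumBelow zero = refl
  triangle≡n+sumBelow (suc n) rewrite triangle≡n+sumBelow n = refl

  PAIR : Cmd
  PAIR = CLR 12 ⨾ CLR 13 ⨾ COPY 10 13 15 ⨾ COPY 11 13 15 ⨾ COPY 11 12 15 ⨾ COPY 13 12 15 ⨾ LOOP 13 (COPY 13 12 15)

  abstract
    PAIR-loop : ∀ n R → R 13 ≡ n → ∃[ R' ] (LOOP 13 (COPY 13 12 15) ⊢ R ⇓ R') × R' 12 ≡ R 12 + sumBelow n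
    PAIR-loop zero R e = R , loop0 e , sym (+-identityʳ _)
    PAIR-loop (suc n) R e with COPY-ok 13 12 15 (λ ()) (λ ()) (λ ()) (update R 13 n)
    ... | R3 , d3 , p3 , q3 , _ with PAIR-loop n R3 q3
    ... | R' , d' , p' = R' , loopS e d3 d' , trans p' (trans (cong (_+ sumBelow n) p3) (+-assoc (R 12) n (sumBelow n)))

  abstract
    PAIR-ok : ∀ R → ∃[ R' ] (PAIR ⊢ R ⇓ R') × R' 12 ≡ pair (R 10) (R 11)
    PAIR-ok R with CLR-ok 12 R
    ... | R1 , d1 , e1 with CLR-ok 13 R1
    ... | R2 , d2 , e2 with COPY-ok 10 13 15 (λ ()) (λ ()) (λ ()) R2
    ... | R3 , d3 , p3 , _ with COPY-ok 11 13 15 (λ ()) (λ ()) (λ ()) R3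
    ... | R4 , d4 , p4 , q4 , _ with COPY-ok 11 12 15 (λ ()) (λ ()) (λ ()) R4
    ... | R5 , d5 , p5 , _ with COPY-ok 13 12 15 (λ ()) (λ ()) (λ ()) R5
    ... | R6 , d6 , p6 , q6 , _ with PAIR-loop (R6 13) R6 refl
    ... | R7 , d7 , p7 = R7 , seq d1 (seq d2 (seq d3 (seq d4 (seq d5 (seq d6 d7))))) , goal
      where
      a : ℕ
      a = R 10
      b : ℕ
      b = R 11
      s13' : R5 13 ≡ a + b
      s13' = trans (kept d5 13) (trans p4 (cong₂ _+_ (trans p3 (cong₂ _+_ e2 (trans (kept d2 10) (kept d1 10))))
              (trans (kept d3 11) (trans (kept d2 11) (kept d1 11)))))
      s13 : R6 13 ≡ a + b
      s13 = trans q6 s13'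
      s12 : R6 12 ≡ b + (a + b)
      s12 = trans p6 (cong₂ _+_ (trans p5 (cong₂ _+_ (trans (kept d4 12) (trans (kept d3 12) (trans (kept d2 12) e1)))
              (trans q4 (trans (kept d3 11) (trans (kept d2 11) (kept d1 11)))))) s13')
      goal : R7 12 ≡ pair a b
      goal = begin
        R7 12                               ≡⟨ p7 ⟩
        R6 12 + sumBelow (R6 13)            ≡⟨ cong₂ (λ u v → u + sumBelow v) s12 s13 ⟩
        b + (a + b) + sumBelow (a + b)      ≡⟨ +-assoc b (a + b) (sumBelow (a + b)) ⟩
        b + (a + b + sumBelow (a + b))      ≡⟨ +-comm b (a + b + sumBelow (a + b)) ⟩
        a + b + sumBelow (a + b) + b        ≡⟨ cong (_+ b) (sym (triangle≡n+sumBelow (a + b))) ⟩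
        triangle (a + b) + b                ≡⟨ sym (pair-def a b) ⟩
        pair a b                            ∎
        where open ≡-Reasoning

  UNPAIR-BODY : Cmd
  UNPAIR-BODY = IFZ 21 (MOV 22 21 ⨾ INC 21) (DEC 21 ⨾ INC 22)

  UNPAIR : Cmd
  UNPAIR = CLR 21 ⨾ CLR 22 ⨾ CLR 23 ⨾ COPY 20 23 24 ⨾ LOOP 23 UNPAIR-BODY


  abstract
    UNPAIR-loop : ∀ n m R → R 23 ≡ n → (R 21 , R 22) ≡ unpair m →
      ∃[ R' ] (LOOP 23 UNPAIR-BODY ⊢ R ⇓ R') × (R' 21 , R' 22) ≡ unpair (m + n)
    UNPAIR-loop zero m R e u = R , loop0 e , trans u (cong unpair (sym (+-identityʳ m)))
    UNPAIR-loop (suc n) m R e u with unpair m in eu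
    ... | zero , b with MOV-ok 22 21 (λ ()) (update R 23 n)
    ... | R2 , d2 , p2 , q2 with UNPAIR-loop n (suc m) (update R2 21 (suc (R2 21))) (kept d2 23)
           (trans (cong₂ _,_ (cong suc (trans p2 (cong (_+ R 22) (,-injectiveˡ {d = b} u)))) q2)
             (trans (cong (λ k → (suc k , 0)) (,-injectiveʳ u)) (sym (unpair-suc0 m b eu))))
    ... | R' , d' , p' = R' , loopS e (ifz0 (,-injectiveˡ u) (seq d2 inc)) d' , trans p' (cong unpair (sym (+-suc m n)))
    UNPAIR-loop (suc n) m R e u | suc a , b with UNPAIR-loop n (suc m)
           (update (update (bump (update R 23 n) 21 a) 21 a) 22 (suc (update (bump (update R 23 n) 21 a) 21 a 22))) refl
           (trans (cong₂ _,_ refl (cong suc (,-injectiveʳ u))) (sym (unpair-sucS m a b eu)))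
    ... | R' , d' , p' = R' , loopS e (ifzS (,-injectiveˡ u) (seq (decS refl) inc)) d' , trans p' (cong unpair (sym (+-suc m n)))

  abstract
    UNPAIR-ok : ∀ R → ∃[ R' ] (UNPAIR ⊢ R ⇓ R') × (R' 21 , R' 22) ≡ unpair (R 20)
    UNPAIR-ok R with CLR-ok 21 R
    ... | R1 , d1 , e1 with CLR-ok 22 R1
    ... | R2 , d2 , e2 with CLR-ok 23 R2
    ... | R3 , d3 , e3 with COPY-ok 20 23 24 (λ ()) (λ ()) (λ ()) R3
    ... | R4 , d4 , p4 , q4 , _ with UNPAIR-loop (R4 23) 0 R4 refl
           (cong₂ _,_ (trans (kept d4 21) (trans (kept d3 21) (trans (kept d2 21) e1))) (trans (kept d4 22) (trans (kept d3 22) e2)))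
    ... | R5 , d5 , p5 = R5 , seq d1 (seq d2 (seq d3 (seq d4 d5))) ,
          trans p5 (cong unpair (trans p4 (cong₂ _+_ e3 (trans (kept d3 20) (trans (kept d2 20) (kept d1 20))))))

open Macros

module ListIteration where

  HEAD : Cmd
  HEAD = DEC 39 ⨾ CLR 20 ⨾ MOV 39 20 ⨾ UNPAIR ⨾ MOV 22 39

  abstract
    HEAD-ok : ∀ R n → R 39 ≡ suc n → ∃[ R' ] (HEAD ⊢ R ⇓ R') × R' 21 ≡ proj₁ (unpair n) × R' 39 ≡ proj₂ (unpair n)
    HEAD-ok R n e with CLR-ok 20 (update R 39 n)
    ... | R2 , d2 , e2 with MOV-ok 39 20 (λ ()) R2
    ... | R3 , d3 , p3 , q3 with UNPAIR-ok R3
    ... | R4 , d4 , p4 with MOV-ok 22 39 (λ ()) R4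
    ... | R5 , d5 , p5 , q5 = R5 , seq (decS e) (seq d2 (seq d3 (seq d4 d5))) ,
       trans (kept d5 21) (trans (,-injectiveˡ p4) (cong (λ k → proj₁ (unpair k)) u)) ,
       trans p5 (trans (cong₂ _+_ (trans (kept d4 39) q3) (,-injectiveʳ p4)) (cong (λ k → proj₂ (unpair k)) u))
      where
      u : R3 20 ≡ n
      u = trans p3 (cong₂ _+_ e2 (kept d2 39))

  iterScratch : ℕ → Bool
  iterScratch x = uses HEAD x ∨ (x ≡ᵇ 38)

  ITER : Cmd → Cmd
  ITER B = LOOP 38 (IFZ 39 SKIP (HEAD ⨾ B))

  decodeList-zero : ∀ x → decodeList 0 x ≡ []
  decodeList-zero zero = refl
  decodeList-zero (suc x) = refl

  decodeList-z : ∀ f → decodeList f 0 ≡ []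
  decodeList-z zero = refl
  decodeList-z (suc f) = refl

  decodeList-s : ∀ f n → decodeList (suc f) (suc n) ≡ proj₁ (unpair n) ∷ decodeList f (proj₂ (unpair n))
  decodeList-s f n with unpair n
  ... | h , t = refl

  module Iter (B : Cmd) (m38 : uses B 38 ≡ false) (m39 : uses B 39 ≡ false)
    (Inv : List ℕ → (ℕ → ℕ) → Set)
    (stable : ∀ ps R R' → Inv ps R → (∀ x → iterScratch x ≡ false → R' x ≡ R x) → Inv ps R')
    (body : ∀ ps h R → Inv ps R → R 21 ≡ h → ∃[ R' ] (B ⊢ R ⇓ R') × Inv (ps ++ h ∷ []) R') where

    abstract
     ITER-ok : ∀ f x ps R → R 38 ≡ f → R 39 ≡ x → Inv ps R →
       ∃[ R' ] (ITER B ⊢ R ⇓ R') × Inv (ps ++ decodeList f x) R'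
     ITER-ok zero x ps R e38 e39 inv = R , loop0 e38 ,
       subst (λ l → Inv l R) (sym (trans (cong (ps ++_) (decodeList-zero x)) (++-identityʳ ps))) inv
     ITER-ok (suc f) zero ps R e38 e39 inv with ITER-ok f 0 ps (update R 38 f) refl e39
          (stable ps R _ inv (λ x s → update-other R 38 f x (≡ᵇ-false x 38 (∨-false-r (uses HEAD x) _ s))))
     ... | R' , d' , inv' = R' , loopS e38 (ifz0 e39 skip) d' ,
           subst (λ l → Inv (ps ++ l) R') (trans (decodeList-z f) (sym (decodeList-z (suc f)))) inv'
     ITER-ok (suc f) (suc n) ps R e38 e39 inv with HEAD-ok (bump (update R 38 f) 39 n) n (trans (bump-eq (update R 38 f) 39 n e39 39) e39)
     ... | R5 , d5 , p5 , q5 with body ps (proj₁ (unpair n)) R5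
            (stable ps R R5 inv (λ x s → trans (frame d5 x (∨-false-l (uses HEAD x) _ s))
               (trans (bump-eq (update R 38 f) 39 n e39 x) (update-other R 38 f x (≡ᵇ-false x 38 (∨-false-r (uses HEAD x) _ s)))))) p5
     ... | R6 , d6 , inv6 with ITER-ok f (proj₂ (unpair n)) (ps ++ proj₁ (unpair n) ∷ []) R6
            (trans (frame d6 38 m38) (trans (kept d5 38) (bump-eq (update R 38 f) 39 n e39 38)))
            (trans (frame d6 39 m39) q5) inv6
     ... | R' , d' , inv' = R' , loopS e38 (ifzS e39 (seq d5 d6)) d' ,
           subst (λ l → Inv l R') (trans (++-assoc ps _ _) (cong (ps ++_) (sym (decodeList-s f n)))) inv'

open ListIteration

module RelocationMacro where

  pushAll : List ℕ → ℕ → ℕ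
  pushAll [] t = t
  pushAll (h ∷ hs) t = pushAll hs (suc (pair h t))

  pushAll-++ : ∀ a b t → pushAll (a ++ b) t ≡ pushAll b (pushAll a t)
  pushAll-++ [] b t = refl
  pushAll-++ (x ∷ a) b t = pushAll-++ a b _

  PUSH-COUNT : Cmd
  PUSH-COUNT = CLR 10 ⨾ CLR 11 ⨾ MOV 21 10 ⨾ MOV 36 11 ⨾ PAIR ⨾ MOV 12 36 ⨾ INC 36 ⨾ INC 37

  abstract
    PUSH-COUNT-ok : ∀ R → ∃[ R' ] (PUSH-COUNT ⊢ R ⇓ R') × R' 36 ≡ suc (pair (R 21) (R 36)) × R' 37 ≡ suc (R 37)
    PUSH-COUNT-ok R =
      CLR-ok 10 R ▸ λ R1 (d1 , e1) →
      CLR-ok 11 R1 ▸ λ R2 (d2 , e2) →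
      MOV-ok 21 10 (λ ()) R2 ▸ λ R3 (d3 , p3 , _) →
      MOV-ok 36 11 (λ ()) R3 ▸ λ R4 (d4 , p4 , q4) →
      PAIR-ok R4 ▸ λ R5 (d5 , p5) →
      MOV-ok 12 36 (λ ()) R5 ▸ λ R6 (d6 , p6 , _) →
      _ , seq d1 (seq d2 (seq d3 (seq d4 (seq d5 (seq d6 (seq inc inc)))))) ,
       cong suc (trans p6 (cong₂ _+_ (trans (kept d5 36) q4) (trans p5 (cong₂ pair
         (trans (kept d4 10) (trans p3 (cong₂ _+_ (trans (kept d2 10) e1) (trans (kept d2 21) (kept d1 21)))))
         (trans p4 (cong₂ _+_ (trans (kept d3 11) e2) (trans (kept d3 36) (trans (kept d2 36) (kept d1 36))))))))) ,
       cong suc (trans (kept d6 37) (trans (kept d5 37) (trans (kept d4 37) (trans (kept d3 37) (trans (kept d2 37) (kept d1 37))))))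

  PushCountInv : List ℕ → (ℕ → ℕ) → Set
  PushCountInv ps R = R 36 ≡ pushAll ps 0 × R 37 ≡ length ps

  abstract
    pushCount-step : ∀ ps h R → PushCountInv ps R → R 21 ≡ h → ∃[ R' ] (PUSH-COUNT ⊢ R ⇓ R') × PushCountInv (ps ++ h ∷ []) R'
    pushCount-step ps h R (a , b) eh =
      PUSH-COUNT-ok R ▸ λ R' (d , p , q) →
      R' , d ,
       trans p (trans (cong₂ (λ u v → suc (pair u v)) eh a) (sym (pushAll-++ ps (h ∷ []) 0))) ,
       trans q (trans (cong suc b) (trans (+-comm 1 (length ps)) (sym (length-++ ps))))

  module IterPushCount = Iter PUSH-COUNT refl refl PushCountInv
    (λ ps R R' ab f → trans (f 36 refl) (proj₁ ab) , trans (f 37 refl) (proj₂ ab))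
    pushCount-step

  MIN-BODY : Cmd
  MIN-BODY = IFZ 43 SKIP (DEC 43 ⨾ INC 42)

  MIN : Cmd
  MIN = CLR 42 ⨾ CLR 43 ⨾ COPY 37 43 35 ⨾ LOOP 22 MIN-BODY

  abstract
    MIN-loop : ∀ n R → R 22 ≡ n → ∃[ R' ] (LOOP 22 MIN-BODY ⊢ R ⇓ R') × R' 42 ≡ R 42 + (n ⊓ R 43)
    MIN-loop zero R e = R , loop0 e , sym (+-identityʳ _)
    MIN-loop (suc n) R e with R 43 in e43
    ... | zero with MIN-loop n (update R 22 n) refl
    ... | R' , d , p = R' , loopS e (ifz0 e43 skip) d , trans p (cong (R 42 +_) (trans (cong (n ⊓_) e43) (⊓-zeroʳ n)))
    MIN-loop (suc n) R e | suc w =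
      MIN-loop n
            (update (update (bump (update R 22 n) 43 w) 43 w) 42 (suc (update (bump (update R 22 n) 43 w) 43 w 42)))
            refl ▸ λ R' (d , p) →
      R' , loopS e (ifzS e43 (seq (decS (trans (bump-eq (update R 22 n) 43 w e43 43) e43)) inc)) d ,
          trans p (trans (cong₂ (λ u v → suc u + (n ⊓ v)) (bump-eq (update R 22 n) 43 w e43 42) (update-same (bump (update R 22 n) 43 w) 43 w)) (sym (+-suc (R 42) (n ⊓ w))))

  abstract
    MIN-ok : ∀ R → ∃[ R' ] (MIN ⊢ R ⇓ R') × R' 42 ≡ R 22 ⊓ R 37 × R' 37 ≡ R 37
    MIN-ok R =
      CLR-ok 42 R ▸ λ R1 (d1 , e1) →
      CLR-ok 43 R1 ▸ λ R2 (d2 , e2) →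
      COPY-ok 37 43 35 (λ ()) (λ ()) (λ ()) R2 ▸ λ R3 (d3 , p3 , q3 , _) →
      MIN-loop (R3 22) R3 refl ▸ λ R4 (d4 , p4) →
      R4 , seq d1 (seq d2 (seq d3 d4)) ,
      trans p4 (cong₂ _+_ (trans (kept d3 42) (trans (kept d2 42) e1)) (cong₂ _⊓_ (trans (kept d3 22) (trans (kept d2 22) (kept d1 22)))
         (trans p3 (cong₂ _+_ e2 (trans (kept d2 37) (kept d1 37)))))) ,
      trans (kept d4 37) (trans q3 (trans (kept d2 37) (kept d1 37)))

  -- Shift registers by K and jump targets by O, first clamping targets to the program length L:
  -- jumping anywhere past the end halts, and the clamped target is the exit of the relocated block.
  relocateCode′ : ℕ → ℕ → ℕ → ℕ → ℕ → ℕ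
  relocateCode′ K O L zero x = pair 0 (x + K)
  relocateCode′ K O L (suc _) x = pair 1 (pair (proj₁ (unpair x) + K) (proj₂ (unpair x) ⊓ L + O))

  relocateCode : ℕ → ℕ → ℕ → ℕ → ℕ
  relocateCode K O L h = relocateCode′ K O L (proj₁ (unpair h)) (proj₂ (unpair h))

  RELOCATE-INC : Cmd
  RELOCATE-INC = CLR 10 ⨾ CLR 11 ⨾ MOV 22 11 ⨾ COPY 31 11 35 ⨾ PAIR ⨾ CLR 41 ⨾ MOV 12 41

  abstract
    RELOCATE-INC-ok : ∀ R → ∃[ R' ] (RELOCATE-INC ⊢ R ⇓ R') × R' 41 ≡ pair 0 (R 22 + R 31) × R' 31 ≡ R 31
    RELOCATE-INC-ok R =
      CLR-ok 10 R ▸ λ R1 (d1 , e1) →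
      CLR-ok 11 R1 ▸ λ R2 (d2 , e2) →
      MOV-ok 22 11 (λ ()) R2 ▸ λ R3 (d3 , p3 , _) →
      COPY-ok 31 11 35 (λ ()) (λ ()) (λ ()) R3 ▸ λ R4 (d4 , p4 , q4 , _) →
      PAIR-ok R4 ▸ λ R5 (d5 , p5) →
      CLR-ok 41 R5 ▸ λ R6 (d6 , e6) →
      MOV-ok 12 41 (λ ()) R6 ▸ λ R7 (d7 , p7 , _) →
      R7 , seq d1 (seq d2 (seq d3 (seq d4 (seq d5 (seq d6 d7))))) ,
      trans p7 (cong₂ _+_ e6 (trans (kept d6 12) (trans p5 (cong₂ pair
        (trans (kept d4 10) (trans (kept d3 10) (trans (kept d2 10) e1)))
        (trans p4 (cong₂ _+_ (trans p3 (cong₂ _+_ e2 (trans (kept d2 22) (kept d1 22)))) (trans (kept d3 31) (trans (kept d2 31) (kept d1 31))))))))) ,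
      trans (kept d7 31) (trans (kept d6 31) (trans (kept d5 31) (trans q4 (trans (kept d3 31) (trans (kept d2 31) (kept d1 31))))))

  DECJZ-FIELDS : Cmd
  DECJZ-FIELDS = CLR 20 ⨾ MOV 22 20 ⨾ UNPAIR ⨾ MIN ⨾ COPY 32 42 35

  abstract
    DECJZ-FIELDS-ok : ∀ R → ∃[ R' ] (DECJZ-FIELDS ⊢ R ⇓ R') × R' 21 ≡ proj₁ (unpair (R 22)) × R' 42 ≡ proj₂ (unpair (R 22)) ⊓ R 37 + R 32
       × R' 32 ≡ R 32 × R' 37 ≡ R 37
    DECJZ-FIELDS-ok R =
      CLR-ok 20 R ▸ λ R1 (d1 , e1) →
      MOV-ok 22 20 (λ ()) R1 ▸ λ R2 (d2 , p2 , _) →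
      UNPAIR-ok R2 ▸ λ R3 (d3 , p3) →
      MIN-ok R3 ▸ λ R4 (d4 , p4 , q4) →
      COPY-ok 32 42 35 (λ ()) (λ ()) (λ ()) R4 ▸ λ R5 (d5 , p5 , q5 , _) →
      let
          u : R2 20 ≡ R 22
          u = trans p2 (cong₂ _+_ e1 (kept d1 22))
          r37 : R3 37 ≡ R 37
          r37 = trans (kept d3 37) (trans (kept d2 37) (kept d1 37))
      in R5 , seq d1 (seq d2 (seq d3 (seq d4 d5))) ,
      trans (kept d5 21) (trans (kept d4 21) (trans (,-injectiveˡ p3) (cong (λ k → proj₁ (unpair k)) u))) ,
      trans p5 (cong₂ _+_ (trans p4 (cong₂ _⊓_ (trans (,-injectiveʳ p3) (cong (λ k → proj₂ (unpair k)) u)) r37))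
         (trans (kept d4 32) (trans (kept d3 32) (trans (kept d2 32) (kept d1 32))))) ,
      trans q5 (trans (kept d4 32) (trans (kept d3 32) (trans (kept d2 32) (kept d1 32)))) ,
      trans (kept d5 37) (trans q4 r37)

  DECJZ-PAIR : Cmd
  DECJZ-PAIR = CLR 10 ⨾ MOV 21 10 ⨾ COPY 31 10 35 ⨾ CLR 11 ⨾ MOV 42 11 ⨾ PAIR

  abstract
    DECJZ-PAIR-ok : ∀ R → ∃[ R' ] (DECJZ-PAIR ⊢ R ⇓ R') × R' 12 ≡ pair (R 21 + R 31) (R 42) × R' 31 ≡ R 31
    DECJZ-PAIR-ok R =
      CLR-ok 10 R ▸ λ R1 (d1 , e1) →
      MOV-ok 21 10 (λ ()) R1 ▸ λ R2 (d2 , p2 , _) →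
      COPY-ok 31 10 35 (λ ()) (λ ()) (λ ()) R2 ▸ λ R3 (d3 , p3 , q3 , _) →
      CLR-ok 11 R3 ▸ λ R4 (d4 , e4) →
      MOV-ok 42 11 (λ ()) R4 ▸ λ R5 (d5 , p5 , _) →
      PAIR-ok R5 ▸ λ R6 (d6 , p6) →
      R6 , seq d1 (seq d2 (seq d3 (seq d4 (seq d5 d6)))) ,
      trans p6 (cong₂ pair
        (trans (kept d5 10) (trans (kept d4 10) (trans p3 (cong₂ _+_ (trans p2 (cong₂ _+_ e1 (kept d1 21))) (trans (kept d2 31) (kept d1 31))))))
        (trans p5 (cong₂ _+_ e4 (trans (kept d4 42) (trans (kept d3 42) (trans (kept d2 42) (kept d1 42))))))) ,
      trans (kept d6 31) (trans (kept d5 31) (trans (kept d4 31) (trans q3 (trans (kept d2 31) (kept d1 31)))))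

  DECJZ-TAG : Cmd
  DECJZ-TAG = CLR 10 ⨾ INC 10 ⨾ CLR 11 ⨾ MOV 12 11 ⨾ PAIR ⨾ CLR 41 ⨾ MOV 12 41

  abstract
    DECJZ-TAG-ok : ∀ R → ∃[ R' ] (DECJZ-TAG ⊢ R ⇓ R') × R' 41 ≡ pair 1 (R 12)
    DECJZ-TAG-ok R =
      CLR-ok 10 R ▸ λ R1 (d1 , e1) →
      CLR-ok 11 (update R1 10 (suc (R1 10))) ▸ λ R3 (d3 , e3) →
      MOV-ok 12 11 (λ ()) R3 ▸ λ R4 (d4 , p4 , _) →
      PAIR-ok R4 ▸ λ R5 (d5 , p5) →
      CLR-ok 41 R5 ▸ λ R6 (d6 , e6) →
      MOV-ok 12 41 (λ ()) R6 ▸ λ R7 (d7 , p7 , _) →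
      R7 , seq d1 (seq inc (seq d3 (seq d4 (seq d5 (seq d6 d7))))) ,
      trans p7 (cong₂ _+_ e6 (trans (kept d6 12) (trans p5 (cong₂ pair
         (trans (kept d4 10) (trans (kept d3 10) (cong suc e1)))
         (trans p4 (cong₂ _+_ e3 (trans (kept d3 12) (kept d1 12))))))))

  RELOCATE-DECJZ : Cmd
  RELOCATE-DECJZ = DECJZ-FIELDS ⨾ DECJZ-PAIR ⨾ DECJZ-TAG

  abstract
    RELOCATE-DECJZ-ok : ∀ R → ∃[ R' ] (RELOCATE-DECJZ ⊢ R ⇓ R') ×
      R' 41 ≡ pair 1 (pair (proj₁ (unpair (R 22)) + R 31) (proj₂ (unpair (R 22)) ⊓ R 37 + R 32))
      × R' 31 ≡ R 31 × R' 32 ≡ R 32 × R' 37 ≡ R 37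
    RELOCATE-DECJZ-ok R =
      DECJZ-FIELDS-ok R ▸ λ R1 (d1 , a1 , b1 , c1 , e1) →
      DECJZ-PAIR-ok R1 ▸ λ R2 (d2 , a2 , b2) →
      DECJZ-TAG-ok R2 ▸ λ R3 (d3 , a3) →
      R3 , seq d1 (seq d2 d3) ,
      trans a3 (cong (pair 1) (trans a2 (cong₂ pair (cong₂ _+_ a1 (kept d1 31)) b1))) ,
      trans (kept d3 31) (trans b2 (kept d1 31)) ,
      trans (kept d3 32) (trans (kept d2 32) c1) ,
      trans (kept d3 37) (trans (kept d2 37) e1)

  CONS : Cmd
  CONS = CLR 10 ⨾ MOV 41 10 ⨾ CLR 11 ⨾ MOV 40 11 ⨾ PAIR ⨾ MOV 12 40 ⨾ INC 40

  abstract
    CONS-ok : ∀ R → ∃[ R' ] (CONS ⊢ R ⇓ R') × R' 40 ≡ suc (pair (R 41) (R 40))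
    CONS-ok R =
      CLR-ok 10 R ▸ λ R1 (d1 , e1) →
      MOV-ok 41 10 (λ ()) R1 ▸ λ R2 (d2 , p2 , _) →
      CLR-ok 11 R2 ▸ λ R3 (d3 , e3) →
      MOV-ok 40 11 (λ ()) R3 ▸ λ R4 (d4 , p4 , q4) →
      PAIR-ok R4 ▸ λ R5 (d5 , p5) →
      MOV-ok 12 40 (λ ()) R5 ▸ λ R6 (d6 , p6 , _) →
      _ , seq d1 (seq d2 (seq d3 (seq d4 (seq d5 (seq d6 inc))))) ,
      cong suc (trans p6 (cong₂ _+_ (trans (kept d5 40) q4) (trans p5 (cong₂ pair
        (trans (kept d4 10) (trans (kept d3 10) (trans p2 (cong₂ _+_ e1 (kept d1 41)))))
        (trans p4 (cong₂ _+_ e3 (trans (kept d3 40) (trans (kept d2 40) (kept d1 40)))))))))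

  SPLIT-INSTR : Cmd
  SPLIT-INSTR = CLR 20 ⨾ MOV 21 20 ⨾ UNPAIR

  abstract
    SPLIT-INSTR-ok : ∀ R → ∃[ R3 ] (SPLIT-INSTR ⊢ R ⇓ R3) × (R3 21 , R3 22) ≡ unpair (R 21)
    SPLIT-INSTR-ok R =
      CLR-ok 20 R ▸ λ R1 (d1 , e1) →
      MOV-ok 21 20 (λ ()) R1 ▸ λ R2 (d2 , p2 , _) →
      UNPAIR-ok R2 ▸ λ R3 (d3 , p3) →
      R3 , seq d1 (seq d2 d3) , trans p3 (cong unpair (trans p2 (cong₂ _+_ e1 (kept d1 21))))

  RELOCATE-BODY : Cmd
  RELOCATE-BODY = SPLIT-INSTR ⨾ IFZ 21 RELOCATE-INC RELOCATE-DECJZ ⨾ CONS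

  RelocateBodySpec : (ℕ → ℕ) → Set
  RelocateBodySpec R = ∃[ R' ] (RELOCATE-BODY ⊢ R ⇓ R') × R' 40 ≡ suc (pair (relocateCode (R 31) (R 32) (R 37) (R 21)) (R 40))
       × R' 31 ≡ R 31 × R' 32 ≡ R 32 × R' 37 ≡ R 37

  relocateCode-inc : ∀ h K O L x → (0 , x) ≡ unpair h → pair 0 (x + K) ≡ relocateCode K O L h
  relocateCode-inc h K O L x e rewrite sym e = refl

  relocateCode-decjz : ∀ h K O L a x → (suc a , x) ≡ unpair h →
    pair 1 (pair (proj₁ (unpair x) + K) (proj₂ (unpair x) ⊓ L + O)) ≡ relocateCode K O L h
  relocateCode-decjz h K O L a x e rewrite sym e = refl

  abstract
    RELOCATE-BODY-cases : ∀ R R3 → (SPLIT-INSTR ⊢ R ⇓ R3) → (R3 21 , R3 22) ≡ unpair (R 21) → ∀ n → R3 21 ≡ n → RelocateBodySpec R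
    RELOCATE-BODY-cases R R3 d p zero ea =
      RELOCATE-INC-ok R3 ▸ λ R4 (d4 , a4 , b4) →
      CONS-ok R4 ▸ λ R5 (d5 , a5) →
      R5 , seq d (seq (ifz0 ea d4) d5) ,
        trans a5 (cong₂ (λ u v → suc (pair u v)) (trans a4 (
            (trans (cong (λ k → pair 0 (R3 22 + k)) (kept d 31)) (relocateCode-inc (R 21) (R 31) (R 32) (R 37) (R3 22) (trans (cong (_, R3 22) (sym ea)) p)))))
          (trans (kept d4 40) (kept d 40))) ,
        trans (kept d5 31) (trans b4 (kept d 31)) , trans (kept d5 32) (trans (kept d4 32) (kept d 32)) , trans (kept d5 37) (trans (kept d4 37) (kept d 37))
    RELOCATE-BODY-cases R R3 d p (suc a) ea =
      RELOCATE-DECJZ-ok (bump R3 21 a) ▸ λ R4 (d4 , a4 , b4 , c4 , e4) →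
      CONS-ok R4 ▸ λ R5 (d5 , a5) →
      R5 , seq d (seq (ifzS ea d4) d5) ,
        trans a5 (cong₂ (λ u v → suc (pair u v)) (trans a4 (trans
             (cong₄ (λ x k o l → pair 1 (pair (proj₁ (unpair x) + k) (proj₂ (unpair x) ⊓ l + o)))
                (bump-eq R3 21 a ea 22) (trans (bump-eq R3 21 a ea 31) (kept d 31)) (trans (bump-eq R3 21 a ea 32) (kept d 32))
                (trans (bump-eq R3 21 a ea 37) (kept d 37)))
               (relocateCode-decjz (R 21) (R 31) (R 32) (R 37) a (R3 22) (trans (cong (_, R3 22) (sym ea)) p))))
          (trans (kept d4 40) (trans (bump-eq R3 21 a ea 40) (kept d 40)))) ,
        trans (kept d5 31) (trans b4 (trans (bump-eq R3 21 a ea 31) (kept d 31))) ,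
        trans (kept d5 32) (trans c4 (trans (bump-eq R3 21 a ea 32) (kept d 32))) ,
        trans (kept d5 37) (trans e4 (trans (bump-eq R3 21 a ea 37) (kept d 37)))

    RELOCATE-BODY-ok : ∀ R → RelocateBodySpec R
    RELOCATE-BODY-ok R = SPLIT-INSTR-ok R ▸ λ R3 (d , p) → RELOCATE-BODY-cases R R3 d p (R3 21) refl

  RelocateInv : ℕ → ℕ → ℕ → ℕ → List ℕ → (ℕ → ℕ) → Set
  RelocateInv K O L T ps R = R 40 ≡ pushAll (map (relocateCode K O L) ps) T × R 31 ≡ K × R 32 ≡ O × R 37 ≡ L

  abstract
    relocate-step : ∀ K O L T ps h R → RelocateInv K O L T ps R → R 21 ≡ h → ∃[ R' ] (RELOCATE-BODY ⊢ R ⇓ R') × RelocateInv K O L T (ps ++ h ∷ []) R'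
    relocate-step K O L T ps h R (a , b , c , e) eh =
      RELOCATE-BODY-ok R ▸ λ R' (d , p , q , r , s) → R' , d ,
        trans p (trans (cong₂ (λ u v → suc (pair u v)) (cong₄ relocateCode b c e eh) a)
          (sym (trans (cong (λ l → pushAll l T) (map-++ (relocateCode K O L) ps (h ∷ []))) (pushAll-++ (map (relocateCode K O L) ps) _ T)))) ,
        trans q b , trans r c , trans s e

  module IterRelocate (K O L T : ℕ) = Iter RELOCATE-BODY refl refl (RelocateInv K O L T)
    (λ ps R R' abce f → trans (f 40 refl) (proj₁ abce) , trans (f 31 refl) (proj₁ (proj₂ abce)) ,
          trans (f 32 refl) (proj₁ (proj₂ (proj₂ abce))) , trans (f 37 refl) (proj₂ (proj₂ (proj₂ abce))))
    (relocate-step K O L T)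

  pushAll-encodeList : ∀ xs ys → pushAll xs (encodeList ys) ≡ encodeList (reverse xs ++ ys)
  pushAll-encodeList [] ys = refl
  pushAll-encodeList (x ∷ xs) ys = trans (pushAll-encodeList xs (x ∷ ys))
     (cong encodeList (sym (trans (cong (_++ ys) (unfold-reverse x xs)) (++-assoc (reverse xs) (x ∷ []) ys))))

  REVERSE-COUNT : Cmd
  REVERSE-COUNT = CLR 36 ⨾ CLR 37 ⨾ CLR 38 ⨾ CLR 39 ⨾ COPY 30 38 35 ⨾ COPY 30 39 35 ⨾ ITER PUSH-COUNT

  RELOCATE-ALL : Cmd
  RELOCATE-ALL = CLR 38 ⨾ COPY 36 38 35 ⨾ CLR 39 ⨾ MOV 36 39 ⨾ CLR 40 ⨾ COPY 33 40 35 ⨾ ITER RELOCATE-BODY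

  -- The first pass reverses the code list and counts its length L; the second relocates each
  -- instruction while pushing it onto the output, which restores the original order.
  RELOCATE : Cmd
  RELOCATE = REVERSE-COUNT ⨾ RELOCATE-ALL

  codeList : ℕ → List ℕ
  codeList c = decodeList c c

  abstract
    REVERSE-COUNT-ok : ∀ R → ∃[ R' ] (REVERSE-COUNT ⊢ R ⇓ R') × R' 36 ≡ pushAll (codeList (R 30)) 0 × R' 37 ≡ length (codeList (R 30))
    REVERSE-COUNT-ok R =
      CLR-ok 36 R ▸ λ R1 (d1 , e1) →
      CLR-ok 37 R1 ▸ λ R2 (d2 , e2) →
      CLR-ok 38 R2 ▸ λ R3 (d3 , e3) →
      CLR-ok 39 R3 ▸ λ R4 (d4 , e4) →
      COPY-ok 30 38 35 (λ ()) (λ ()) (λ ()) R4 ▸ λ R5 (d5 , p5 , q5 , _) →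
      COPY-ok 30 39 35 (λ ()) (λ ()) (λ ()) R5 ▸ λ R6 (d6 , p6 , q6 , _) →
      let c30 : R5 30 ≡ R 30
          c30 = trans q5 (trans (kept d4 30) (trans (kept d3 30) (trans (kept d2 30) (kept d1 30))))
      in
      IterPushCount.ITER-ok (R 30) (R 30) [] R6
        (trans (kept d6 38) (trans p5 (cong₂ _+_ (trans (kept d4 38) e3) (trans (kept d4 30) (trans (kept d3 30) (trans (kept d2 30) (kept d1 30)))))))
        (trans p6 (cong₂ _+_ (trans (kept d5 39) e4) c30))
        (trans (kept d6 36) (trans (kept d5 36) (trans (kept d4 36) (trans (kept d3 36) (trans (kept d2 36) e1)))) ,
         trans (kept d6 37) (trans (kept d5 37) (trans (kept d4 37) (trans (kept d3 37) e2)))) ▸ λ R7 (d7 , a7 , b7) →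
      R7 , seq d1 (seq d2 (seq d3 (seq d4 (seq d5 (seq d6 d7))))) , a7 , b7

  codeList-pushAll : ∀ l → decodeList (pushAll l 0) (pushAll l 0) ≡ reverse l
  codeList-pushAll l = trans (cong (λ k → decodeList k k) (trans (pushAll-encodeList l []) (cong encodeList (++-identityʳ (reverse l)))))
              (decodeList-self (reverse l))

  abstract
    RELOCATE-ALL-ok : ∀ R l → R 36 ≡ pushAll l 0 → R 37 ≡ length l →
      ∃[ R' ] (RELOCATE-ALL ⊢ R ⇓ R') × R' 40 ≡ pushAll (map (relocateCode (R 31) (R 32) (length l)) (reverse l)) (R 33) × R' 37 ≡ length l
    RELOCATE-ALL-ok R l e36 e37 =
      CLR-ok 38 R ▸ λ R8 (d8 , e8) →
      COPY-ok 36 38 35 (λ ()) (λ ()) (λ ()) R8 ▸ λ R9 (d9 , p9 , q9 , _) →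
      CLR-ok 39 R9 ▸ λ R10 (d10 , e10) →
      MOV-ok 36 39 (λ ()) R10 ▸ λ R11 (d11 , p11 , _) →
      CLR-ok 40 R11 ▸ λ R12 (d12 , e12) →
      COPY-ok 33 40 35 (λ ()) (λ ()) (λ ()) R12 ▸ λ R13 (d13 , p13 , _) →
      let f = pushAll l 0
          r36 : R8 36 ≡ f
          r36 = trans (kept d8 36) e36
      in
      IterRelocate.ITER-ok (R 31) (R 32) (length l) (R 33) f f [] R13
        (trans (kept d13 38) (trans (kept d12 38) (trans (kept d11 38) (trans (kept d10 38) (trans p9 (cong₂ _+_ e8 r36))))))
        (trans (kept d13 39) (trans (kept d12 39) (trans p11 (cong₂ _+_ e10 (trans (kept d10 36) (trans q9 r36))))))
        (trans p13 (cong₂ _+_ e12 (trans (kept d12 33) (trans (kept d11 33) (trans (kept d10 33) (trans (kept d9 33) (kept d8 33)))))) ,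
         trans (kept d13 31) (trans (kept d12 31) (trans (kept d11 31) (trans (kept d10 31) (trans (kept d9 31) (kept d8 31))))) ,
         trans (kept d13 32) (trans (kept d12 32) (trans (kept d11 32) (trans (kept d10 32) (trans (kept d9 32) (kept d8 32))))) ,
         trans (kept d13 37) (trans (kept d12 37) (trans (kept d11 37) (trans (kept d10 37) (trans (kept d9 37) (trans (kept d8 37) e37)))))) ▸
      λ R' (d , a , _ , _ , e) →
      R' , seq d8 (seq d9 (seq d10 (seq d11 (seq d12 (seq d13 d))))) ,
        trans a (cong (λ k → pushAll (map (relocateCode (R 31) (R 32) (length l)) k) (R 33)) (codeList-pushAll l)) , e

    RELOCATE-ok : ∀ R → ∃[ R' ] (RELOCATE ⊢ R ⇓ R') ×
       R' 40 ≡ pushAll (map (relocateCode (R 31) (R 32) (length (codeList (R 30)))) (reverse (codeList (R 30)))) (R 33) × R' 37 ≡ length (codeList (R 30))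
    RELOCATE-ok R =
      REVERSE-COUNT-ok R ▸ λ R1 (d1 , a1 , b1) →
      RELOCATE-ALL-ok R1 (codeList (R 30)) a1 b1 ▸ λ R2 (d2 , a2 , b2) →
      R2 , seq d1 d2 , trans a2 (cong₃ (λ k o t → pushAll (map (relocateCode k o (length (codeList (R 30)))) (reverse (codeList (R 30)))) t)
         (kept d1 31) (kept d1 32) (kept d1 33)) , b2

open RelocationMacro

module Relocation where

  relocate : ℕ → ℕ → ℕ → Instr → Instr
  relocate K O L (inc x) = inc (x + K)
  relocate K O L (decjz r j) = decjz (r + K) (j ⊓ L + O)

  decodeInstr-relocateCode : ∀ K O L h → decodeInstr (relocateCode K O L h) ≡ relocate K O L (decodeInstr h)
  decodeInstr-relocateCode K O L h with unpair h
  ... | zero , x = decodeInstr-encodeInstr (inc (x + K))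
  ... | suc a , x with unpair x
  ...   | r , j = decodeInstr-encodeInstr (decjz (r + K) (j ⊓ L + O))

  relocatedCodes : ℕ → ℕ → ℕ → List ℕ
  relocatedCodes K O c = map (relocateCode K O (length (codeList c))) (codeList c)

  prependRelocated : ℕ → ℕ → ℕ → ℕ → ℕ
  prependRelocated K O c T = pushAll (map (relocateCode K O (length (codeList c))) (reverse (codeList c))) T

  prependRelocated-encodeList : ∀ K O c ys → prependRelocated K O c (encodeList ys) ≡ encodeList (relocatedCodes K O c ++ ys)
  prependRelocated-encodeList K O c ys = begin
    pushAll (map f (reverse (codeList c))) (encodeList ys)  ≡⟨ pushAll-encodeList (map f (reverse (codeList c))) ys ⟩
    encodeList (reverse (map f (reverse (codeList c))) ++ ys) ≡⟨ cong (λ l → encodeList (reverse l ++ ys)) (reverse-map f (codeList c)) ⟩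
    encodeList (reverse (reverse (map f (codeList c))) ++ ys) ≡⟨ cong (λ l → encodeList (l ++ ys)) (reverse-involutive (map f (codeList c))) ⟩
    encodeList (relocatedCodes K O c ++ ys)                  ∎
    where
    open ≡-Reasoning
    f = relocateCode K O (length (codeList c))

  mapL-++ : ∀ {A B : Set} (f : A → B) xs ys → mapL f (xs ++ ys) ≡ mapL f xs ++ mapL f ys
  mapL-++ f [] ys = refl
  mapL-++ f (x ∷ xs) ys = cong (f x ∷_) (mapL-++ f xs ys)

  mapL-relocateCode : ∀ K O L l → mapL decodeInstr (map (relocateCode K O L) l) ≡ mapL (relocate K O L) (mapL decodeInstr l)
  mapL-relocateCode K O L [] = refl
  mapL-relocateCode K O L (h ∷ l) = cong₂ _∷_ (decodeInstr-relocateCode K O L h) (mapL-relocateCode K O L l)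

  length-mapL : ∀ {A B : Set} (f : A → B) xs → length (mapL f xs) ≡ length xs
  length-mapL f [] = refl
  length-mapL f (x ∷ xs) = cong suc (length-mapL f xs)

  relocatedBlock : ℕ → ℕ → ℕ → List Instr
  relocatedBlock K O c = mapL (relocate K O (length (decode c))) (decode c)

  decode-relocated-++ : ∀ K O c ys → mapL decodeInstr (relocatedCodes K O c ++ ys) ≡ relocatedBlock K O c ++ mapL decodeInstr ys
  decode-relocated-++ K O c ys = trans (mapL-++ decodeInstr _ ys)
    (cong (_++ mapL decodeInstr ys) (trans (mapL-relocateCode K O _ (codeList c))
       (cong (λ L → mapL (relocate K O L) (decode c)) (sym (length-mapL decodeInstr (codeList c))))))

  decode-encodeList : ∀ xs → decode (encodeList xs) ≡ mapL decodeInstr xs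
  decode-encodeList xs = cong (mapL decodeInstr) (decodeList-self xs)

open Relocation

module Simulation where

  register : Instr → ℕ
  register (inc r) = r
  register (decjz r j) = r

  RegistersBelow : ℕ → Prog → Set
  RegistersBelow B [] = ⊤
  RegistersBelow B (i ∷ p) = register i < B × RegistersBelow B p

  maxRegister : Prog → ℕ
  maxRegister [] = 0
  maxRegister (i ∷ p) = register i ⊔ maxRegister p

  registersBelow-maxRegister : ∀ p → RegistersBelow (suc (maxRegister p)) p
  registersBelow-maxRegister [] = tt
  registersBelow-maxRegister (i ∷ p) = s≤s (m≤m⊔n (register i) (maxRegister p)) , below-mono (registersBelow-maxRegister p)
    where
    below-mono : ∀ {q} → RegistersBelow (suc (maxRegister p)) q → RegistersBelow (suc (register i ⊔ maxRegister p)) q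
    below-mono {[]} _ = tt
    below-mono {j ∷ q} (lt , b) = ≤-trans lt (s≤s (m≤n⊔m (register i) (maxRegister p))) , below-mono b

  nth-below : ∀ {B} p c i → RegistersBelow B p → nth p c ≡ just i → register i < B
  nth-below (x ∷ p) zero i (lt , _) refl = lt
  nth-below (x ∷ p) (suc c) i (_ , b) e = nth-below p c i b e

  nth-just-< : ∀ p c i → nth p c ≡ just i → c < length p
  nth-just-< (x ∷ p) zero i e = s≤s z≤n
  nth-just-< (x ∷ p) (suc c) i e = s≤s (nth-just-< p c i e)

  nth-nothing-≥ : ∀ p c → nth p c ≡ nothing → length p ≤ c
  nth-nothing-≥ [] c e = z≤n
  nth-nothing-≥ (x ∷ p) zero ()
  nth-nothing-≥ (x ∷ p) (suc c) e = s≤s (nth-nothing-≥ p c e)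

  nth-≥ : ∀ p c → length p ≤ c → nth p c ≡ nothing
  nth-≥ [] c _ = refl
  nth-≥ (x ∷ p) (suc c) (s≤s le) = nth-≥ p c le

  nth-mapL : ∀ (f : Instr → Instr) p c i → nth p c ≡ just i → nth (mapL f p) c ≡ just (f i)
  nth-mapL f (x ∷ p) zero i refl = refl
  nth-mapL f (x ∷ p) (suc c) i e = nth-mapL f p c i e

  step-nothing : ∀ p s → step p s ≡ nothing → nth p (State.pc s) ≡ nothing
  step-nothing p (st c R) e with nth p c
  ... | nothing = refl
  ... | just (inc r) with e
  ...   | ()
  step-nothing p (st c R) e | just (decjz r j) with R r
  ... | zero with e
  ...   | ()
  step-nothing p (st c R) e | just (decjz r j) | suc v with e
  ...   | ()

  data StepView (p : Prog) (c : ℕ) (R : ℕ → ℕ) : Maybe State → Set where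
    vinc : ∀ r → nth p c ≡ just (inc r) → StepView p c R (just (st (suc c) (update R r (suc (R r)))))
    vjz  : ∀ r j → nth p c ≡ just (decjz r j) → R r ≡ 0 → StepView p c R (just (st j R))
    vdec : ∀ r j v → nth p c ≡ just (decjz r j) → R r ≡ suc v → StepView p c R (just (st (suc c) (update R r v)))
    vhalt : nth p c ≡ nothing → StepView p c R nothing

  stepView : ∀ p c R → StepView p c R (step p (st c R))
  stepView p c R with nth p c in e
  ... | nothing = vhalt e
  ... | just (inc r) = vinc r e
  ... | just (decjz r j) with R r in e2
  ...   | zero = vjz r j e e2
  ...   | suc v = vdec r j v e e2

  run-halt : ∀ k p s v → run k p s ≡ just v → ∃[ s' ] Steps p s s' × step p s' ≡ nothing × State.regs s' 0 ≡ v
  run-halt zero p s v ()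
  run-halt (suc k) p s v e with step p s in es
  ... | nothing = s , done , es , just-injective e
  ... | just s1 with run-halt k p s1 v e
  ...   | s' , ss , h , r = s' , more es ss , h , r

  run-after-Steps : ∀ {p s s'} → Steps p s s' → ∀ N {v} → run N p s ≡ just v → ∃[ N' ] run N' p s' ≡ just v
  run-after-Steps done N e = N , e
  run-after-Steps (more x ss) zero ()
  run-after-Steps {p} {s} (more {s' = s1} x ss) (suc N) e = run-after-Steps ss N (trans (sym (run-step N p s s1 x)) e)


  module Sim (Q : Prog) (O K B : ℕ) (P : Prog) (below : RegistersBelow B P)
             (cont : Contains Q O (mapL (relocate K O (length P)) P)) where

    L = length P

    Simulates : State → State → Set
    Simulates s t = State.pc t ≡ O + (State.pc s ⊓ L) × (∀ x → x < B → State.regs t (x + K) ≡ State.regs s x)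
              × (∀ y → y < K → State.regs t y ≡ 0)

    upd-rel : ∀ (R T : ℕ → ℕ) r v → r < B → (∀ x → x < B → T (x + K) ≡ R x) →
              ∀ x → x < B → update T (r + K) v (x + K) ≡ update R r v x
    upd-rel R T r v rb rel x xb with x ≟ r
    ... | yes refl = update-same T (x + K) v
    ... | no ne = trans (update-other T (r + K) v (x + K) (λ e → ne (+-cancelʳ-≡ K x r e))) (rel x xb)

    upd-frame : ∀ (T : ℕ → ℕ) r v → (∀ y → y < K → T y ≡ 0) → ∀ y → y < K → update T (r + K) v y ≡ 0
    upd-frame T r v kept y yk = trans (update-other T (r + K) v y (λ e → <⇒≢ (≤-trans yk (m≤n+m K r)) e)) (kept y yk)

    sim-step : ∀ {s t s'} → Simulates s t → step P s ≡ just s' → ∃[ t' ] step Q t ≡ just t' × Simulates s' t'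
    sim-step {st c R} {st d T} (pcr , rr , kept) e = go (step P (st c R)) (stepView P c R) e
      where
      cl : c < L → c ⊓ L ≡ c
      cl lt = m≤n⇒m⊓n≡m (<⇒≤ lt)
      nqf : ∀ i → nth P c ≡ just i → nth Q d ≡ just (relocate K O L i)
      nqf i n = subst (λ k → nth Q k ≡ just (relocate K O L i)) (sym (trans pcr (cong (O +_) (cl (nth-just-< P c _ n)))))
                  (Contains.get cont c _ (nth-mapL (relocate K O L) P c i n))
      go : ∀ m → StepView P c R m → ∀ {s'} → m ≡ just s' → ∃[ t' ] step Q (st d T) ≡ just t' × Simulates s' t'
      go _ (vhalt x) ()
      go _ (vinc r n) refl =
        let lt = nth-just-< P c _ n
            nq = nqf _ n
            rb = nth-below P c _ below n
        in _ , trans (step-inc Q d T (r + K) nq) (cong (λ k → just (st (suc k) _)) (trans pcr (cong (O +_) (cl lt)))) ,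
           trans (sym (+-suc O c)) (cong (O +_) (sym (m≤n⇒m⊓n≡m lt))) ,
           (λ x xb → trans (cong (λ k → update T (r + K) (suc k) (x + K)) (rr r rb)) (upd-rel R T r (suc (R r)) rb rr x xb)) ,
           upd-frame T r _ kept
      go _ (vjz r j n z) refl =
        let lt = nth-just-< P c _ n
            nq = nqf _ n
            rb = nth-below P c _ below n
        in _ , step-jz Q d T (r + K) _ nq (trans (rr r rb) z) , +-comm (j ⊓ L) O , rr , kept
      go _ (vdec r j v n z) refl =
        let lt = nth-just-< P c _ n
            nq = nqf _ n
            rb = nth-below P c _ below n
        in _ , trans (step-dec Q d T (r + K) _ v nq (trans (rr r rb) z)) (cong (λ k → just (st (suc k) _)) (trans pcr (cong (O +_) (cl lt)))) ,
           trans (sym (+-suc O c)) (cong (O +_) (sym (m≤n⇒m⊓n≡m lt))) ,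
           upd-rel R T r v rb rr , upd-frame T r v kept

    sim-halt : ∀ {s t} → Simulates s t → step P s ≡ nothing → State.pc t ≡ O + L
    sim-halt {s} (pcr , _) e = trans pcr (cong (O +_) (m≥n⇒m⊓n≡n (nth-nothing-≥ P _ (step-nothing P s e))))

    simulate-Steps : ∀ {s s'} → Steps P s s' → ∀ {t} → Simulates s t → ∃[ t' ] Steps Q t t' × Simulates s' t'
    simulate-Steps done r = _ , done , r
    simulate-Steps (more x ss) r with sim-step r x
    ... | t1 , e1 , r1 with simulate-Steps ss r1
    ...   | t' , ss' , r' = t' , more e1 ss' , r'

    simulate-run : ∀ N {s t w} → run N Q t ≡ just w → Simulates s t →
         ∃[ s' ] ∃[ t' ] Steps P s s' × step P s' ≡ nothing × Steps Q t t' × Simulates s' t' × ∃[ N' ] run N' Q t' ≡ just w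
    simulate-run zero () r
    simulate-run (suc N) {s} {t} e r with step P s in es
    ... | nothing = s , t , done , es , done , r , suc N , e
    ... | just s1 with sim-step r es
    ...   | t1 , e1 , r1 with simulate-run N (trans (sym (run-step N Q t t1 e1)) e) r1
    ...     | s' , t' , a , b , c , d , f = s' , t' , more es a , b , more e1 c , d , f

open Simulation

module Gluing where

  stashInput : ℕ → Prog
  stashInput K = decjz 0 3 ∷ inc K ∷ decjz 1 0 ∷ []

  restoreOutput : ℕ → Prog
  restoreOutput K = decjz K 3 ∷ inc 0 ∷ decjz 1 0 ∷ []

  inputRegs-other : ∀ n y → y ≢ 0 → inputRegs n y ≡ 0
  inputRegs-other n zero ne = ⊥-elim (ne refl)
  inputRegs-other n (suc y) ne = refl

  -- Q moves the input to register K, runs e on registers shifted by K, moves its output back to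
  -- register 0 and runs f. At that point every register below K other than 0 is still 0 and f
  -- only uses registers below Bf < K, so f runs as on a fresh input.
  module Glued (K Bf e ef : ℕ) (belowF : RegistersBelow Bf (decode ef)) (zB : 0 < Bf) (BfK : Bf < K) (oneK : 1 < K) where

    Pe = decode e
    Pf = decode ef
    Le = length Pe
    Be = suc (maxRegister Pe)

    stashBlock : Prog
    stashBlock = mapL (relocate 0 0 3) (stashInput K)
    restoreBlock : Prog
    restoreBlock = mapL (relocate 0 (3 + Le) 3) (restoreOutput K)
    eBlock = relocatedBlock K 3 e
    fBlock = relocatedBlock 0 (6 + Le) ef

    Q : Prog
    Q = stashBlock ++ (eBlock ++ (restoreBlock ++ fBlock))

    -- Relocating by 0 turns register K into K + 0, which is not definitionally K.
    K0 = K + 0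

    K0≢0 : K0 ≢ 0
    K0≢0 e = <⇒≢ (≤-trans (s≤s z≤n) oneK) (sym (trans (sym (+-identityʳ K)) e))
    K0≢1 : 1 ≢ K0
    K0≢1 e = <⇒≢ oneK (trans e (+-identityʳ K))

    length-eBlock : length eBlock ≡ Le
    length-eBlock = length-mapL _ Pe

    Q⊇eBlock : Contains Q 3 eBlock
    Q⊇eBlock = cont-left eBlock _ (cont-right stashBlock _ (cont-refl Q))

    Q⊇restore++f : Contains Q (3 + Le) (restoreBlock ++ fBlock)
    Q⊇restore++f = subst (λ k → Contains Q (3 + k) (restoreBlock ++ fBlock)) length-eBlock (cont-right eBlock _ (cont-right stashBlock _ (cont-refl Q)))

    Q⊇fBlock : Contains Q (6 + Le) fBlock
    Q⊇fBlock = subst (λ k → Contains Q k fBlock) (cong suc (cong suc (cong suc (+-comm Le 3)))) (cont-right restoreBlock fBlock Q⊇restore++f)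

    Q⊇restoreBlock : Contains Q (3 + Le) restoreBlock
    Q⊇restoreBlock = cont-left restoreBlock fBlock Q⊇restore++f

    length-Q : length Q ≡ 6 + Le + length fBlock
    length-Q = trans (cong (λ k → 3 + k) (trans (length-++ eBlock {restoreBlock ++ fBlock}) (cong₂ _+_ length-eBlock (length-++ restoreBlock {fBlock}))))
      (cong (λ k → suc (suc (suc k))) (trans (+-suc Le _) (cong suc (trans (+-suc Le _) (cong suc (+-suc Le (length fBlock)))))))

    stash-Steps : ∀ m R → R 0 ≡ m → R 1 ≡ 0 → ∃[ R' ] Steps Q (st 0 R) (st 3 R') × R' 0 ≡ 0 × R' K0 ≡ R K0 + m
                × (∀ y → y ≢ 0 → y ≢ K0 → R' y ≡ R y)
    stash-Steps zero R e0 e1 = R , more (step-jz Q 0 R 0 3 refl e0) done , e0 , sym (+-identityʳ _) , λ _ _ _ → refl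
    stash-Steps (suc m) R e0 e1 =
      let R1 = update R 0 m
          R2 = update R1 K0 (suc (R1 K0))
          z2 : R2 1 ≡ 0
          z2 = trans (update-other R1 K0 _ 1 K0≢1) (trans (update-other R 0 m 1 (λ ())) e1)
      in case stash-Steps m R2 (trans (update-other R1 K0 _ 0 (λ x → K0≢0 (sym x))) (update-same R 0 m)) z2 of λ where
        (R' , ss , a , b , c) → R' ,
          more (step-dec Q 0 R 0 3 m refl e0) (more (step-inc Q 1 R1 K0 refl) (more (step-jz Q 2 R2 1 0 refl z2) ss)) ,
          a , trans b (trans (cong (_+ m) (trans (update-same R1 K0 _) (cong suc (update-other R 0 m K0 K0≢0)))) (sym (+-suc _ m))) ,
          λ y y0 yK → trans (c y y0 yK) (trans (update-other R1 K0 _ y yK) (update-other R 0 m y y0))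

    M = 3 + Le

    restore-0 : nth Q M ≡ just (decjz K0 (6 + Le))
    restore-0 = cont-head Q⊇restoreBlock
    restore-1 : nth Q (suc M) ≡ just (inc 0)
    restore-1 = cont-head (cont-tail Q⊇restoreBlock)
    restore-2 : nth Q (suc (suc M)) ≡ just (decjz 1 M)
    restore-2 = cont-head (cont-tail (cont-tail Q⊇restoreBlock))

    restore-Steps : ∀ m T → T K0 ≡ m → T 1 ≡ 0 → ∃[ sumBelow ] Steps Q (st M T) (st (6 + Le) sumBelow) × sumBelow 0 ≡ T 0 + m
                × (∀ y → y ≢ 0 → y ≢ K0 → sumBelow y ≡ T y)
    restore-Steps zero T ek e1 = T , more (step-jz Q M T K0 (6 + Le) restore-0 ek) done , sym (+-identityʳ _) , λ _ _ _ → refl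
    restore-Steps (suc m) T ek e1 =
      let T1 = update T K0 m
          T2 = update T1 0 (suc (T1 0))
          z2 : T2 1 ≡ 0
          z2 = trans (update-other T1 0 (suc (T1 0)) 1 (λ ())) (trans (update-other T K0 m 1 K0≢1) e1)
      in case restore-Steps m T2 (trans (update-other T1 0 (suc (T1 0)) K0 K0≢0) (update-same T K0 m)) z2 of λ where
        (sumBelow , ss , a , c) → sumBelow ,
          more (step-dec Q M T K0 (6 + Le) m restore-0 ek) (more (step-inc Q (suc M) T1 0 restore-1) (more (step-jz Q (suc (suc M)) T2 1 M restore-2 z2) ss)) ,
          trans a (trans (cong (_+ m) (trans (update-same T1 0 _) (cong suc (update-other T K0 m 0 (λ x → K0≢0 (sym x)))))) (sym (+-suc _ m))) ,
          λ y y0 yK → trans (c y y0 yK) (trans (update-other T1 0 _ y y0) (update-other T K0 m y yK))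

    module SE = Sim Q 3 K Be Pe (registersBelow-maxRegister Pe) Q⊇eBlock
    module SF = Sim Q (6 + Le) 0 Bf Pf belowF Q⊇fBlock

    suc+K≢K0 : ∀ x → suc x + K ≢ K0
    suc+K≢K0 x eq = <⇒≢ (s≤s (m≤n+m K x)) (sym (trans eq (+-identityʳ K)))

    <K⇒≢K0 : ∀ y → y < K → y ≢ K0
    <K⇒≢K0 y lt eq = <⇒≢ lt (trans eq (+-identityʳ K))

    preStage : ∀ n → ∃[ T1 ] Steps Q (initial n) (st 3 T1) × SE.Simulates (initial n) (st 3 T1)
    preStage n with stash-Steps n (inputRegs n) refl refl
    ... | T1 , ss , a , b , c = T1 , ss , refl , rr , frm
      where
      rr : ∀ x → x < Be → T1 (x + K) ≡ inputRegs n x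
      rr zero _ = trans (cong T1 (sym (+-identityʳ K))) (trans b (cong (_+ n) (inputRegs-other n K0 K0≢0)))
      rr (suc x) _ = c (suc x + K) (λ ()) (suc+K≢K0 x)
      frm : ∀ y → y < K → T1 y ≡ 0
      frm zero _ = a
      frm (suc y) lt = c (suc y) (λ ()) (<K⇒≢K0 (suc y) lt)

    midStage : ∀ {s t} → SE.Simulates s t → step Pe s ≡ nothing →
      ∃[ T3 ] Steps Q t (st (6 + Le) T3) × SF.Simulates (initial (State.regs s 0)) (st (6 + Le) T3)
    midStage {s} {t} r h with SE.sim-halt r h
    ... | pe with r
    ... | _ , rr , kept with restore-Steps (State.regs t K0) (State.regs t) refl (kept 1 oneK)
    ... | T3 , ss , a , c = T3 , subst (λ k → Steps Q (st k (State.regs t)) (st (6 + Le) T3)) (sym pe) ss ,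
        sym (+-identityʳ (6 + Le)) , rr' , λ y ()
      where
      w0 : State.regs t K0 ≡ State.regs s 0
      w0 = trans (cong (State.regs t) (+-identityʳ K)) (rr 0 (s≤s z≤n))
      rr' : ∀ x → x < Bf → T3 (x + 0) ≡ inputRegs (State.regs s 0) x
      rr' zero _ = trans a (trans (cong (_+ State.regs t K0) (kept 0 (≤-trans (s≤s z≤n) oneK))) w0)
      rr' (suc x) lt = trans (c (suc (x + 0)) (λ ()) (<K⇒≢K0 _ lK)) (kept _ lK)
        where lK : suc (x + 0) < K
              lK = ≤-trans (s≤s (s≤s (≤-reflexive (+-identityʳ x)))) (≤-trans lt (<⇒≤ BfK))

    finStage : ∀ {s t} → SF.Simulates s t → step Pf s ≡ nothing → step Q t ≡ nothing × State.regs t 0 ≡ State.regs s 0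
    finStage {s} {t} r h with SF.sim-halt r h
    ... | pe with r
    ... | _ , rr , _ = step-halt Q (State.pc t) (State.regs t)
             (nth-≥ Q (State.pc t) (≤-reflexive (trans length-Q (trans (cong (6 + Le +_) (length-mapL _ Pf)) (sym pe))))) ,
           rr 0 zB

    Q-↓= : ∀ n w y → e · n ↓= w → ef · w ↓= y → ∃[ k ] run k Q (initial n) ≡ just y
    Q-↓= n w y (k1 , r1) (k2 , r2) with run-halt k1 Pe (initial n) w r1 | preStage n
    ... | Se , ssE , he , we | T1 , ssP , relE with SE.simulate-Steps ssE relE
    ... | te , ssQE , relE' with midStage relE' he
    ... | T3 , ssM , relF with run-halt k2 Pf (initial w) y r2
    ... | Sf , ssF , hf , yf with SF.simulate-Steps ssF (subst (λ v → SF.Simulates (initial v) (st (6 + Le) T3)) we relF)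
    ... | tf , ssQF , relF' with finStage relF' hf
    ... | hq , vq with Steps-halt (Steps-trans ssP (Steps-trans ssQE (Steps-trans ssM ssQF))) hq
    ... | k , rk = k , trans rk (cong just (trans vq yf))

    Q-↓=⁻¹ : ∀ n v N → run N Q (initial n) ≡ just v → ∃[ w ] (e · n ↓= w) × (ef · w ↓= v)
    Q-↓=⁻¹ n v N rq with preStage n
    ... | T1 , ssP , relE with run-after-Steps ssP N rq
    ... | N1 , r1 with SE.simulate-run N1 r1 relE
    ... | Se , te , ssE , he , ssQE , relE' , N2 , r2 with midStage relE' he
    ... | T3 , ssM , relF with run-after-Steps ssM N2 r2
    ... | N3 , r3 with SF.simulate-run N3 r3 relF
    ... | Sf , tf , ssF , hf , ssQF , relF' , N4 , r4 with finStage relF' hf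
    ... | hq , vq = State.regs Se 0 , Steps-halt ssE he ,
          subst (λ u → ef · State.regs Se 0 ↓= u) (trans (sym vq) (run-deterministic 1 N4 Q tf (run-halted 0 Q tf hq) r4))
            (Steps-halt ssF hf)

open Gluing

module ComposeMacro where

  RELOCATE-INTO : ℕ → Cmd
  RELOCATE-INTO d = CLR 33 ⨾ MOV 5 33 ⨾ RELOCATE ⨾ MOV 40 d

  abstract
    RELOCATE-INTO-5-ok : ∀ R → ∃[ R' ] (RELOCATE-INTO 5 ⊢ R ⇓ R') × R' 5 ≡ prependRelocated (R 31) (R 32) (R 30) (R 5)
    RELOCATE-INTO-5-ok R =
      CLR-ok 33 R ▸ λ R1 (d1 , e1) →
      MOV-ok 5 33 (λ ()) R1 ▸ λ R2 (d2 , p2 , q2) →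
      RELOCATE-ok R2 ▸ λ R3 (d3 , p3 , _) →
      MOV-ok 40 5 (λ ()) R3 ▸ λ R4 (d4 , p4 , _) →
      R4 , seq d1 (seq d2 (seq d3 d4)) ,
      trans p4 (cong₂ _+_ (trans (kept d3 5) q2) (trans p3
        (cong₄ (λ k o c t → pushAll (map (relocateCode k o (length (codeList c))) (reverse (codeList c))) t)
           (trans (kept d2 31) (kept d1 31)) (trans (kept d2 32) (kept d1 32)) (trans (kept d2 30) (kept d1 30))
           (trans p2 (cong₂ _+_ e1 (kept d1 5))))))

    RELOCATE-INTO-0-ok : ∀ R → ∃[ R' ] (RELOCATE-INTO 0 ⊢ R ⇓ R') × R' 0 ≡ R 0 + prependRelocated (R 31) (R 32) (R 30) (R 5)
    RELOCATE-INTO-0-ok R =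
      CLR-ok 33 R ▸ λ R1 (d1 , e1) →
      MOV-ok 5 33 (λ ()) R1 ▸ λ R2 (d2 , p2 , q2) →
      RELOCATE-ok R2 ▸ λ R3 (d3 , p3 , _) →
      MOV-ok 40 0 (λ ()) R3 ▸ λ R4 (d4 , p4 , _) →
      R4 , seq d1 (seq d2 (seq d3 d4)) ,
      trans p4 (cong₂ _+_ (trans (kept d3 0) (trans (kept d2 0) (kept d1 0))) (trans p3
        (cong₄ (λ k o c t → pushAll (map (relocateCode k o (length (codeList c))) (reverse (codeList c))) t)
           (trans (kept d2 31) (kept d1 31)) (trans (kept d2 32) (kept d1 32)) (trans (kept d2 30) (kept d1 30))
           (trans p2 (cong₂ _+_ e1 (kept d1 5))))))

  ADDC-ok : ∀ r n R → ∃[ R' ] (ADDC r n ⊢ R ⇓ R') × R' r ≡ R r + n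
  ADDC-ok r n R = addc R r n , addcR , addc-same R r n

  -- The code of the composed program is assembled from its last block to its first.
  module ComposeCode (Kc ef stashCode restoreCode : ℕ) where

    LENGTH-STAGE : Cmd
    LENGTH-STAGE = CLR 30 ⨾ COPY 2 30 3 ⨾ CLR 31 ⨾ CLR 32 ⨾ CLR 33 ⨾ RELOCATE ⨾ CLR 4 ⨾ COPY 37 4 3

    F-STAGE : Cmd
    F-STAGE = CLR 5 ⨾ CLR 30 ⨾ ADDC 30 ef ⨾ CLR 31 ⨾ CLR 32 ⨾ ADDC 32 6 ⨾ COPY 4 32 3 ⨾ RELOCATE-INTO 5

    RESTORE-STAGE : Cmd
    RESTORE-STAGE = CLR 30 ⨾ ADDC 30 restoreCode ⨾ CLR 31 ⨾ CLR 32 ⨾ ADDC 32 3 ⨾ COPY 4 32 3 ⨾ RELOCATE-INTO 5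

    E-STAGE : Cmd
    E-STAGE = CLR 30 ⨾ COPY 2 30 3 ⨾ CLR 31 ⨾ ADDC 31 Kc ⨾ CLR 32 ⨾ ADDC 32 3 ⨾ RELOCATE-INTO 5

    STASH-STAGE : Cmd
    STASH-STAGE = CLR 30 ⨾ ADDC 30 stashCode ⨾ CLR 31 ⨾ CLR 32 ⨾ RELOCATE-INTO 0

    COMPOSE : Cmd
    COMPOSE = MOV 0 2 ⨾ LENGTH-STAGE ⨾ F-STAGE ⨾ RESTORE-STAGE ⨾ E-STAGE ⨾ STASH-STAGE

    abstract
      LENGTH-STAGE-ok : ∀ R → ∃[ R' ] (LENGTH-STAGE ⊢ R ⇓ R') × R' 4 ≡ length (codeList (R 2)) × R' 2 ≡ R 2
      LENGTH-STAGE-ok R =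
        CLR-ok 30 R ▸ λ R1 (d1 , e1) →
        COPY-ok 2 30 3 (λ ()) (λ ()) (λ ()) R1 ▸ λ R2 (d2 , p2 , q2 , _) →
        CLR-ok 31 R2 ▸ λ R3 (d3 , _) →
        CLR-ok 32 R3 ▸ λ R4 (d4 , _) →
        CLR-ok 33 R4 ▸ λ R5 (d5 , _) →
        RELOCATE-ok R5 ▸ λ R6 (d6 , _ , p6) →
        CLR-ok 4 R6 ▸ λ R7 (d7 , e7) →
        COPY-ok 37 4 3 (λ ()) (λ ()) (λ ()) R7 ▸ λ R8 (d8 , p8 , _) →
        R8 , seq d1 (seq d2 (seq d3 (seq d4 (seq d5 (seq d6 (seq d7 d8)))))) ,
        trans p8 (cong₂ _+_ e7 (trans (kept d7 37) (trans p6 (cong (λ c → length (codeList c))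
          (trans (kept d5 30) (trans (kept d4 30) (trans (kept d3 30) (trans p2 (cong₂ _+_ e1 (kept d1 2)))))))))) ,
        trans (kept d8 2) (trans (kept d7 2) (trans (kept d6 2) (trans (kept d5 2) (trans (kept d4 2) (trans (kept d3 2) (trans q2 (kept d1 2)))))))

      F-STAGE-ok : ∀ R → ∃[ R' ] (F-STAGE ⊢ R ⇓ R') × R' 5 ≡ prependRelocated 0 (6 + R 4) ef 0 × R' 4 ≡ R 4 × R' 2 ≡ R 2
      F-STAGE-ok R =
        CLR-ok 5 R ▸ λ R0 (d0 , e0) →
        CLR-ok 30 R0 ▸ λ R1 (d1 , e1) →
        ADDC-ok 30 ef R1 ▸ λ R2 (d2 , p2) →
        CLR-ok 31 R2 ▸ λ R3 (d3 , e3) →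
        CLR-ok 32 R3 ▸ λ R4 (d4 , e4) →
        ADDC-ok 32 6 R4 ▸ λ R5 (d5 , p5) →
        COPY-ok 4 32 3 (λ ()) (λ ()) (λ ()) R5 ▸ λ R6 (d6 , p6 , q6 , _) →
        RELOCATE-INTO-5-ok R6 ▸ λ R7 (d7 , p7) →
        let r4 : R5 4 ≡ R 4
            r4 = trans (kept d5 4) (trans (kept d4 4) (trans (kept d3 4) (trans (kept d2 4) (trans (kept d1 4) (kept d0 4)))))
        in
        R7 , seq d0 (seq d1 (seq d2 (seq d3 (seq d4 (seq d5 (seq d6 d7)))))) ,
        trans p7 (cong₄ prependRelocated (trans (kept d6 31) (trans (kept d5 31) (trans (kept d4 31) e3)))
            (trans p6 (cong₂ _+_ (trans p5 (cong (_+ 6) e4)) r4))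
            (trans (kept d6 30) (trans (kept d5 30) (trans (kept d4 30) (trans (kept d3 30) (trans p2 (cong (_+ ef) e1))))))
            (trans (kept d6 5) (trans (kept d5 5) (trans (kept d4 5) (trans (kept d3 5) (trans (kept d2 5) (trans (kept d1 5) e0))))))) ,
        trans (kept d7 4) (trans q6 r4) ,
        trans (kept d7 2) (trans (kept d6 2) (trans (kept d5 2) (trans (kept d4 2) (trans (kept d3 2) (trans (kept d2 2) (trans (kept d1 2) (kept d0 2)))))))

      RESTORE-STAGE-ok : ∀ R → ∃[ R' ] (RESTORE-STAGE ⊢ R ⇓ R') × R' 5 ≡ prependRelocated 0 (3 + R 4) restoreCode (R 5) × R' 2 ≡ R 2
      RESTORE-STAGE-ok R =
        CLR-ok 30 R ▸ λ R1 (d1 , e1) →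
        ADDC-ok 30 restoreCode R1 ▸ λ R2 (d2 , p2) →
        CLR-ok 31 R2 ▸ λ R3 (d3 , e3) →
        CLR-ok 32 R3 ▸ λ R4 (d4 , e4) →
        ADDC-ok 32 3 R4 ▸ λ R5 (d5 , p5) →
        COPY-ok 4 32 3 (λ ()) (λ ()) (λ ()) R5 ▸ λ R6 (d6 , p6 , q6 , _) →
        RELOCATE-INTO-5-ok R6 ▸ λ R7 (d7 , p7) →
        R7 , seq d1 (seq d2 (seq d3 (seq d4 (seq d5 (seq d6 d7))))) ,
        trans p7 (cong₄ prependRelocated (trans (kept d6 31) (trans (kept d5 31) (trans (kept d4 31) e3)))
            (trans p6 (cong₂ _+_ (trans p5 (cong (_+ 3) e4)) (trans (kept d5 4) (trans (kept d4 4) (trans (kept d3 4) (trans (kept d2 4) (kept d1 4)))))))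
            (trans (kept d6 30) (trans (kept d5 30) (trans (kept d4 30) (trans (kept d3 30) (trans p2 (cong (_+ restoreCode) e1))))))
            (trans (kept d6 5) (trans (kept d5 5) (trans (kept d4 5) (trans (kept d3 5) (trans (kept d2 5) (kept d1 5))))))) ,
        trans (kept d7 2) (trans (kept d6 2) (trans (kept d5 2) (trans (kept d4 2) (trans (kept d3 2) (trans (kept d2 2) (kept d1 2))))))

      E-STAGE-ok : ∀ R → ∃[ R' ] (E-STAGE ⊢ R ⇓ R') × R' 5 ≡ prependRelocated Kc 3 (R 2) (R 5)
      E-STAGE-ok R =
        CLR-ok 30 R ▸ λ R1 (d1 , e1) →
        COPY-ok 2 30 3 (λ ()) (λ ()) (λ ()) R1 ▸ λ R2 (d2 , p2 , _) →
        CLR-ok 31 R2 ▸ λ R3 (d3 , e3) →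
        ADDC-ok 31 Kc R3 ▸ λ R4 (d4 , p4) →
        CLR-ok 32 R4 ▸ λ R5 (d5 , e5) →
        ADDC-ok 32 3 R5 ▸ λ R6 (d6 , p6) →
        RELOCATE-INTO-5-ok R6 ▸ λ R7 (d7 , p7) →
        R7 , seq d1 (seq d2 (seq d3 (seq d4 (seq d5 (seq d6 d7))))) ,
        trans p7 (cong₄ prependRelocated (trans (kept d6 31) (trans (kept d5 31) (trans p4 (cong (_+ Kc) e3))))
            (trans p6 (cong (_+ 3) e5))
            (trans (kept d6 30) (trans (kept d5 30) (trans (kept d4 30) (trans (kept d3 30) (trans p2 (cong₂ _+_ e1 (kept d1 2)))))))
            (trans (kept d6 5) (trans (kept d5 5) (trans (kept d4 5) (trans (kept d3 5) (trans (kept d2 5) (kept d1 5)))))))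

      STASH-STAGE-ok : ∀ R → ∃[ R' ] (STASH-STAGE ⊢ R ⇓ R') × R' 0 ≡ R 0 + prependRelocated 0 0 stashCode (R 5)
      STASH-STAGE-ok R =
        CLR-ok 30 R ▸ λ R1 (d1 , e1) →
        ADDC-ok 30 stashCode R1 ▸ λ R2 (d2 , p2) →
        CLR-ok 31 R2 ▸ λ R3 (d3 , e3) →
        CLR-ok 32 R3 ▸ λ R4 (d4 , e4) →
        RELOCATE-INTO-0-ok R4 ▸ λ R5 (d5 , p5) →
        R5 , seq d1 (seq d2 (seq d3 (seq d4 d5))) ,
        trans p5 (cong₂ _+_ (trans (kept d4 0) (trans (kept d3 0) (trans (kept d2 0) (kept d1 0))))
          (cong₄ prependRelocated (trans (kept d4 31) e3) e4 (trans (kept d4 30) (trans (kept d3 30) (trans p2 (cong (_+ stashCode) e1))))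
            (trans (kept d4 5) (trans (kept d3 5) (trans (kept d2 5) (kept d1 5))))))

    composeIndex : ℕ → ℕ
    composeIndex n =
      prependRelocated 0 0 stashCode (prependRelocated Kc 3 n
        (prependRelocated 0 (3 + length (codeList n)) restoreCode (prependRelocated 0 (6 + length (codeList n)) ef 0)))

    abstract
      COMPOSE-ok : ∀ n → ∃[ R' ] (COMPOSE ⊢ inputRegs n ⇓ R') × R' 0 ≡ composeIndex n
      COMPOSE-ok n =
        MOV-ok 0 2 (λ ()) (inputRegs n) ▸ λ R1 (d1 , p1 , q1) →
        LENGTH-STAGE-ok R1 ▸ λ R2 (d2 , a2 , b2) →
        F-STAGE-ok R2 ▸ λ R3 (d3 , a3 , b3 , c3) →
        RESTORE-STAGE-ok R3 ▸ λ R4 (d4 , a4 , b4) →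
        E-STAGE-ok R4 ▸ λ R5 (d5 , a5) →
        STASH-STAGE-ok R5 ▸ λ R6 (d6 , a6) →
        let e2 : R2 2 ≡ n
            e2 = trans b2 p1
            l4 : R3 4 ≡ length (codeList n)
            l4 = trans b3 (trans a2 (cong (λ c → length (codeList c)) p1))
        in
        R6 , seq d1 (seq d2 (seq d3 (seq d4 (seq d5 d6)))) ,
        trans a6 (cong₂ _+_ (trans (kept d5 0) (trans (kept d4 0) (trans (kept d3 0) (trans (kept d2 0) q1))))
          (cong (prependRelocated 0 0 stashCode) (trans a5 (cong₂ (prependRelocated Kc 3) (trans b4 (trans c3 e2))
            (trans a4 (cong₂ (λ l t → prependRelocated 0 (3 + l) restoreCode t) l4
              (trans a3 (cong (λ l → prependRelocated 0 (6 + l) ef 0) (trans a2 (cong (λ c → length (codeList c)) p1))))))))))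

open ComposeMacro

module Composition where

  relocatedBlock-encode : ∀ K O p → relocatedBlock K O (encode p) ≡ mapL (relocate K O (length p)) p
  relocatedBlock-encode K O p rewrite decode-encode p = refl

  module Comp (ef : ℕ) where
    Pf = decode ef
    Bf = suc (maxRegister Pf)
    Kc = suc (suc Bf)
    abstract
      stashCode : ℕ
      stashCode = encode (stashInput Kc)
      restoreCode : ℕ
      restoreCode = encode (restoreOutput Kc)
      stashCode-eq : stashCode ≡ encode (stashInput Kc)
      stashCode-eq = refl
      restoreCode-eq : restoreCode ≡ encode (restoreOutput Kc)
      restoreCode-eq = refl

    open ComposeCode Kc ef stashCode restoreCode public

    compose : ℕ → ℕ
    compose = composeIndex

    compose-computable : Computable compose
    compose-computable = computable-by COMPOSE compose refl COMPOSE-ok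

    module C (e : ℕ) = Glued Kc Bf e ef (registersBelow-maxRegister Pf) (s≤s z≤n) (≤-trans (n<1+n Bf) (n≤1+n (suc Bf))) (s≤s (s≤s z≤n))

    codeLength : ℕ → ℕ
    codeLength e = length (codeList e)

    codeLength≡ : ∀ e → codeLength e ≡ C.Le e
    codeLength≡ e = sym (length-mapL decodeInstr (codeList e))

    decode-compose : ∀ e → decode (compose e) ≡ C.Q e
    decode-compose e = begin
      decode (compose e)
        ≡⟨ cong (λ t → decode (prependRelocated 0 0 stashCode (prependRelocated Kc 3 e (prependRelocated 0 M restoreCode t))))
                (prependRelocated-encodeList 0 F ef []) ⟩
      decode (prependRelocated 0 0 stashCode (prependRelocated Kc 3 e (prependRelocated 0 M restoreCode (encodeList csF))))
        ≡⟨ cong (λ t → decode (prependRelocated 0 0 stashCode (prependRelocated Kc 3 e t))) (prependRelocated-encodeList 0 M restoreCode csF) ⟩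
      decode (prependRelocated 0 0 stashCode (prependRelocated Kc 3 e (encodeList csM)))
        ≡⟨ cong (λ t → decode (prependRelocated 0 0 stashCode t)) (prependRelocated-encodeList Kc 3 e csM) ⟩
      decode (prependRelocated 0 0 stashCode (encodeList csE))
        ≡⟨ cong decode (prependRelocated-encodeList 0 0 stashCode csE) ⟩
      decode (encodeList (relocatedCodes 0 0 stashCode ++ csE))
        ≡⟨ decode-encodeList _ ⟩
      mapL decodeInstr (relocatedCodes 0 0 stashCode ++ csE)
        ≡⟨ decode-relocated-++ 0 0 stashCode csE ⟩
      relocatedBlock 0 0 stashCode ++ mapL decodeInstr csE
        ≡⟨ cong (relocatedBlock 0 0 stashCode ++_) (decode-relocated-++ Kc 3 e csM) ⟩
      relocatedBlock 0 0 stashCode ++ relocatedBlock Kc 3 e ++ mapL decodeInstr csM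
        ≡⟨ cong (λ z → relocatedBlock 0 0 stashCode ++ relocatedBlock Kc 3 e ++ z) (decode-relocated-++ 0 M restoreCode csF) ⟩
      relocatedBlock 0 0 stashCode ++ relocatedBlock Kc 3 e ++ relocatedBlock 0 M restoreCode ++ mapL decodeInstr csF
        ≡⟨ cong (λ z → relocatedBlock 0 0 stashCode ++ relocatedBlock Kc 3 e ++ relocatedBlock 0 M restoreCode ++ z)
                (trans (decode-relocated-++ 0 F ef []) (++-identityʳ _)) ⟩
      relocatedBlock 0 0 stashCode ++ relocatedBlock Kc 3 e ++ relocatedBlock 0 M restoreCode ++ relocatedBlock 0 F ef
        ≡⟨ cong₂ _++_ (trans (cong (relocatedBlock 0 0) stashCode-eq) (relocatedBlock-encode 0 0 (stashInput Kc)))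
             (cong (relocatedBlock Kc 3 e ++_) (cong₂ _++_
               (trans (cong (relocatedBlock 0 M) restoreCode-eq) (trans (relocatedBlock-encode 0 M (restoreOutput Kc))
                 (cong (λ l → mapL (relocate 0 (3 + l) 3) (restoreOutput Kc)) (codeLength≡ e))))
               (cong (λ l → relocatedBlock 0 (6 + l) ef) (codeLength≡ e)))) ⟩
      C.Q e ∎
      where
      open ≡-Reasoning
      M = 3 + codeLength e
      F = 6 + codeLength e
      csF = relocatedCodes 0 F ef ++ []
      csM = relocatedCodes 0 M restoreCode ++ csF
      csE = relocatedCodes Kc 3 e ++ csM

    compose-↓= : ∀ e n w y → e · n ↓= w → ef · w ↓= y → compose e · n ↓= y
    compose-↓= e n w y a b = subst (λ P → ∃[ k ] run k P (initial n) ≡ just y) (sym (decode-compose e)) (C.Q-↓= e n w y a b)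

    compose-↓=⁻¹ : ∀ e n v → compose e · n ↓= v → ∃[ w ] (e · n ↓= w) × (ef · w ↓= v)
    compose-↓=⁻¹ e n v (N , r) = C.Q-↓=⁻¹ e n v N (subst (λ P → run N P (initial n) ≡ just v) (decode-compose e) r)

open Composition

module ConstantIndex where

  OUTPUT : ℕ → Cmd
  OUTPUT n = CLR 0 ⨾ ADDC 0 n

  constIndex : ℕ → ℕ
  constIndex n = indexOf (OUTPUT n)

  constIndex-converges : ∀ n m → constIndex n · m ↓= n
  constIndex-converges n m with CLR-ok 0 (inputRegs m)
  ... | R1 , d1 , e1 = subst (constIndex n · m ↓=_) (trans (addc-same R1 0 n) (cong (_+ n) e1))
                         (indexOf-converges (OUTPUT n) m (addc R1 0 n) (seq d1 addcR) refl)

  prependInc0 : ℕ → ℕ → ℕ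
  prependInc0 zero t = t
  prependInc0 (suc m) t = prependInc0 m (suc (pair 0 t))

  prependInc0-cons : ∀ m t → prependInc0 m (suc (pair 0 t)) ≡ suc (pair 0 (prependInc0 m t))
  prependInc0-cons zero t = refl
  prependInc0-cons (suc m) t = prependInc0-cons m _

  encode-replicate-inc0 : ∀ n → encodeList (mapL encodeInstr (replicate n (inc 0))) ≡ prependInc0 n 0
  encode-replicate-inc0 zero = refl
  encode-replicate-inc0 (suc n) = trans (cong (λ t → suc (pair (pair 0 0) t)) (encode-replicate-inc0 n))
     (trans (cong (λ a → suc (pair a (prependInc0 n 0))) pair-0-0) (sym (prependInc0-cons n 0)))

  exitCode loopCode : ℕ
  exitCode = encodeInstr (decjz 0 2)
  loopCode = encodeInstr (decjz 1 0)

  constIndex≡ : ∀ n → constIndex n ≡ suc (pair exitCode (suc (pair loopCode (prependInc0 n 0))))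
  constIndex≡ n = cong (λ t → suc (pair exitCode (suc (pair loopCode t)))) (encode-replicate-inc0 n)

  PUSH-INC0 : Cmd
  PUSH-INC0 = LOOP 2 (CLR 41 ⨾ CONS)

  CONST-INDEX : Cmd
  CONST-INDEX = MOV 0 2 ⨾ CLR 40 ⨾ PUSH-INC0 ⨾ CLR 41 ⨾ ADDC 41 loopCode ⨾ CONS ⨾ CLR 41 ⨾ ADDC 41 exitCode ⨾ CONS ⨾ MOV 40 0

  abstract
    PUSH-INC0-ok : ∀ m R → R 2 ≡ m → ∃[ R' ] (PUSH-INC0 ⊢ R ⇓ R') × R' 40 ≡ prependInc0 m (R 40)
    PUSH-INC0-ok zero R e = R , loop0 e , refl
    PUSH-INC0-ok (suc m) R e =
      CLR-ok 41 (update R 2 m) ▸ λ R2 (d2 , e2) →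
      CONS-ok R2 ▸ λ R3 (d3 , p3) →
      PUSH-INC0-ok m R3 (trans (kept d3 2) (kept d2 2)) ▸ λ R' (d' , p') →
      R' , loopS e (seq d2 d3) d' , trans p' (cong (prependInc0 m) (trans p3 (cong₂ (λ a b → suc (pair a b)) e2 (kept d2 40))))

    CONST-INDEX-ok : ∀ n → ∃[ R' ] (CONST-INDEX ⊢ inputRegs n ⇓ R') × R' 0 ≡ constIndex n
    CONST-INDEX-ok n =
      MOV-ok 0 2 (λ ()) (inputRegs n) ▸ λ R1 (d1 , p1 , q1) →
      CLR-ok 40 R1 ▸ λ R2 (d2 , e2) →
      PUSH-INC0-ok (R2 2) R2 refl ▸ λ R3 (d3 , p3) →
      CLR-ok 41 R3 ▸ λ R4 (d4 , e4) →
      CONS-ok (addc R4 41 loopCode) ▸ λ R5 (d5 , p5) →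
      CLR-ok 41 R5 ▸ λ R6 (d6 , e6) →
      CONS-ok (addc R6 41 exitCode) ▸ λ R7 (d7 , p7) →
      MOV-ok 40 0 (λ ()) R7 ▸ λ R8 (d8 , p8 , _) →
      let v3 : R3 40 ≡ prependInc0 n 0
          v3 = trans p3 (cong₂ prependInc0 (trans (kept d2 2) p1) e2)
          a2 : addc R4 41 loopCode 41 ≡ loopCode
          a2 = trans (addc-same R4 41 loopCode) (cong (_+ loopCode) e4)
          b2 : addc R4 41 loopCode 40 ≡ prependInc0 n 0
          b2 = trans (addc-other R4 41 loopCode 40 (λ ())) (trans (kept d4 40) v3)
          v5 : R5 40 ≡ suc (pair loopCode (prependInc0 n 0))
          v5 = trans p5 (cong₂ (λ a b → suc (pair a b)) a2 b2)
          a1 : addc R6 41 exitCode 41 ≡ exitCode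
          a1 = trans (addc-same R6 41 exitCode) (cong (_+ exitCode) e6)
          b1 : addc R6 41 exitCode 40 ≡ suc (pair loopCode (prependInc0 n 0))
          b1 = trans (addc-other R6 41 exitCode 40 (λ ())) (trans (kept d6 40) v5)
          v7 : R7 40 ≡ suc (pair exitCode (suc (pair loopCode (prependInc0 n 0))))
          v7 = trans p7 (cong₂ (λ a b → suc (pair a b)) a1 b1)
          z7 : R7 0 ≡ 0
          z7 = trans (kept d7 0) (trans (addc-other R6 41 exitCode 0 (λ ())) (trans (kept d6 0) (trans (kept d5 0)
                 (trans (addc-other R4 41 loopCode 0 (λ ())) (trans (kept d4 0) (trans (kept d3 0) (trans (kept d2 0) q1)))))))
          v8 : R8 0 ≡ suc (pair exitCode (suc (pair loopCode (prependInc0 n 0))))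
          v8 = trans p8 (trans (cong (_+ R7 40) z7) v7)
      in
      R8 , seq d1 (seq d2 (seq d3 (seq d4 (seq addcR (seq d5 (seq d6 (seq addcR (seq d7 d8)))))))) ,
      trans v8 (sym (constIndex≡ n))

  constIndex-computable : Computable constIndex
  constIndex-computable = computable-by CONST-INDEX constIndex refl CONST-INDEX-ok

open ConstantIndex

divergentProg : Prog
divergentProg = decjz 1 0 ∷ []

divergentIndex : ℕ
divergentIndex = encode divergentProg

run-divergentProg : ∀ k n → run k divergentProg (initial n) ≡ nothing
run-divergentProg zero    n = refl
run-divergentProg (suc k) n = run-divergentProg k n

divergentIndex-diverges : ∀ n v → ¬ (divergentIndex · n ↓= v)
divergentIndex-diverges n v (k , halts)
  with trans (sym (run-divergentProg k n)) (subst (λ P → run k P (initial n) ≡ just v) (decode-encode divergentProg) halts)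
... | ()

Jump-constIndex⁺ : (E : Rel ℕ 0ℓ) → ∀ n n' → E n n' → Jump E (constIndex n) (constIndex n')
Jump-constIndex⁺ E n n' n~n' =
    (λ m v n↓v → 0 , n' , constIndex-converges n' 0 , subst (λ u → E u n') (↓=-deterministic (constIndex-converges n m) n↓v) n~n')
  , (λ m w n'↓w → 0 , n , constIndex-converges n 0 , subst (E n) (↓=-deterministic (constIndex-converges n' m) n'↓w) n~n')

Jump-constIndex⁻ : (E : Rel ℕ 0ℓ) → ∀ n n' → Jump E (constIndex n) (constIndex n') → E n n'
Jump-constIndex⁻ E n n' (forth , _) with forth 0 n (constIndex-converges n 0)
... | m , w , n'↓w , n~w = subst (E n) (↓=-deterministic n'↓w (constIndex-converges n' m)) n~w

¬Jump-divergentIndex-constIndex : (E : Rel ℕ 0ℓ) → ∀ n → ¬ Jump E divergentIndex (constIndex n)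
¬Jump-divergentIndex-constIndex E n (_ , back) with back 0 n (constIndex-converges n 0)
... | m , v , div↓v , _ = divergentIndex-diverges m v div↓v

≤c-Jump : (E : Rel ℕ 0ℓ) → E ≤c Jump E
≤c-Jump E = constIndex , constIndex-computable , λ n n' → Jump-constIndex⁺ E n n' , Jump-constIndex⁻ E n n'

¬FinitelyManyClasses : {E : Rel ℕ 0ℓ} → IsEquivalence E → (G : ℕ → ℕ) → (∀ x y → E (G x) (G y) → E x y) →
  (y₀ : ℕ) → (∀ x → ¬ E y₀ (G x)) → ¬ FinitelyManyClasses E
¬FinitelyManyClasses {E} isEq G reflects y₀ y₀∉image (k , rep , cover) = contradiction
  where
  open IsEquivalence isEq renaming (sym to E-sym; trans to E-trans)

  orbit : ℕ → ℕ
  orbit zero    = y₀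
  orbit (suc i) = G (orbit i)

  orbit-inequivalent : ∀ i d → ¬ E (orbit i) (orbit (suc i + d))
  orbit-inequivalent zero    d = y₀∉image (orbit d)
  orbit-inequivalent (suc i) d e = orbit-inequivalent i d (reflects (orbit i) (orbit (suc i + d)) e)

  classOf : Fin (suc k) → Fin k
  classOf i = proj₁ (cover (orbit (toℕ i)))

  contradiction : ⊥
  contradiction with FinP.pigeonhole (n<1+n k) classOf
  ... | i , j , i<j , same with m≤n⇒∃[o]m+o≡n i<j
  ... | d , i+d≡j = orbit-inequivalent (toℕ i) d (subst (λ t → E (orbit (toℕ i)) (orbit t)) (sym i+d≡j)
        (E-trans (proj₂ (cover (orbit (toℕ i))))
                 (E-sym (subst (λ c → E (orbit (toℕ j)) (rep c)) (sym same) (proj₂ (cover (orbit (toℕ j))))))))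

Jump≰c : {E : Rel ℕ 0ℓ} → IsEquivalence E → FinitelyManyClasses E → ¬ (Jump E ≤c E)
Jump≰c {E} isEq finite (g , _ , g-reduces) =
  ¬FinitelyManyClasses isEq (λ x → g (constIndex x))
    (λ x y e → Jump-constIndex⁻ E x y (proj₂ (g-reduces (constIndex x) (constIndex y)) e))
    (g divergentIndex)
    (λ x e → ¬Jump-divergentIndex-constIndex E x (proj₂ (g-reduces divergentIndex (constIndex x)) e))
    finite

module _ {E F : Rel ℕ 0ℓ} {f : ℕ → ℕ} (ef : ℕ) (ef-computes : ∀ n → ef · n ↓= f n)
         (f-reduces : ∀ n n' → (E n n' → F (f n) (f n')) × (F (f n) (f n') → E n n')) where
  open Comp ef

  compose-↓=ᶠ : ∀ e n w → e · n ↓= w → compose e · n ↓= f w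
  compose-↓=ᶠ e n w e↓w = compose-↓= e n w (f w) e↓w (ef-computes w)

  compose-↓=ᶠ⁻¹ : ∀ e n v → compose e · n ↓= v → ∃[ w ] (e · n ↓= w) × v ≡ f w
  compose-↓=ᶠ⁻¹ e n v h↓v = compose-↓=⁻¹ e n v h↓v ▸ λ w (e↓w , ef↓v) → w , e↓w , ↓=-deterministic ef↓v (ef-computes w)

  Jump-compose⁺ : ∀ e e' → Jump E e e' → Jump F (compose e) (compose e')
  Jump-compose⁺ e e' (forth , back) = forth′ , back′
    where
    forth′ : ∀ n v → compose e · n ↓= v → ∃[ m ] ∃[ w ] (compose e' · m ↓= w × F v w)
    forth′ n v h↓v = compose-↓=ᶠ⁻¹ e n v h↓v ▸ λ w (e↓w , v≡fw) → forth n w e↓w ▸ λ m (w' , e'↓w' , w~w') →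
      m , f w' , compose-↓=ᶠ e' m w' e'↓w' , subst (λ u → F u (f w')) (sym v≡fw) (proj₁ (f-reduces w w') w~w')
    back′ : ∀ m w → compose e' · m ↓= w → ∃[ n ] ∃[ v ] (compose e · n ↓= v × F v w)
    back′ m w h↓w = compose-↓=ᶠ⁻¹ e' m w h↓w ▸ λ w₀ (e'↓w₀ , w≡fw₀) → back m w₀ e'↓w₀ ▸ λ n (v , e↓v , v~w₀) →
      n , f v , compose-↓=ᶠ e n v e↓v , subst (F (f v)) (sym w≡fw₀) (proj₁ (f-reduces v w₀) v~w₀)

  Jump-compose⁻ : ∀ e e' → Jump F (compose e) (compose e') → Jump E e e'
  Jump-compose⁻ e e' (forth , back) = forth′ , back′
    where
    forth′ : ∀ n v → e · n ↓= v → ∃[ m ] ∃[ w ] (e' · m ↓= w × E v w)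
    forth′ n v e↓v = forth n (f v) (compose-↓=ᶠ e n v e↓v) ▸ λ m (u , h↓u , fv~u) → compose-↓=ᶠ⁻¹ e' m u h↓u ▸ λ w (e'↓w , u≡fw) →
      m , w , e'↓w , proj₂ (f-reduces v w) (subst (F (f v)) u≡fw fv~u)
    back′ : ∀ m w → e' · m ↓= w → ∃[ n ] ∃[ v ] (e · n ↓= v × E v w)
    back′ m w e'↓w = back m (f w) (compose-↓=ᶠ e' m w e'↓w) ▸ λ n (u , h↓u , u~fw) → compose-↓=ᶠ⁻¹ e n u h↓u ▸ λ v (e↓v , u≡fv) →
      n , v , e↓v , proj₂ (f-reduces v w) (subst (λ x → F x (f w)) u≡fv u~fw)

  Jump-compose-reduces : Jump E ≤c Jump F
  Jump-compose-reduces = compose , compose-computable , λ e e' → Jump-compose⁺ e e' , Jump-compose⁻ e e'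

Jump-monotone : {E F : Rel ℕ 0ℓ} → E ≤c F → Jump E ≤c Jump F
Jump-monotone (f , (ef , ef-computes) , f-reduces) = Jump-compose-reduces ef ef-computes f-reduces

proposition2p2 : (E F : Rel ℕ 0ℓ) → IsEquivalence E → IsEquivalence F →
    (E ≤c Jump E)
    × (FinitelyManyClasses E → E <c Jump E)
    × (E ≤c F → Jump E ≤c Jump F)
proposition2p2 E F isEqE _ = ≤c-Jump E , (λ finite → ≤c-Jump E , Jump≰c isEqE finite) , Jump-monotone
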